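{- Let $P$ be a finite graded bounded poset with minimum $\widehat0$, maximum $\widehat1$ and rank function $\rho$. Then the $\chi$-Chow polynomial of $P$ is $$\mathrm{H}_P(x)=\sum_{\widehat0=p_0<p_1<\dots<p_m\le\widehat1}\ \prod_{i=1}^m\frac{x\big(x^{\rho(p_i)-\rho(p_{i-1})-1}-1\big)}{x-1},$$ where the sum is over all chains of the indicated form (any $m\ge0$).
   Context: For a finite graded bounded poset $P$, $\rho(w)$ is the length of any saturated chain from $\widehat0$ to $w$, and $\rho_{st}=\rho(t)-\rho(s)$. The incidence algebra $\mathcal{I}(P)$ consists of maps $a$ assigning to each closed interval $[s,t]$ a polynomial $a_{st}(x)\in\mathbb{Z}[x]$, with product $(ab)_{st}=\sum_{s\le w\le t}a_{sw}b_{wt}$. The characteristic function is $\chi_{st}(x)=\sum_{s\le w\le t}\mu_{sw}x^{\rho_{wt}}$, where $\mu$ is the Möbius function; it is a kernel (i.e. $\chi_{ss}=1$ and $\chi^{ -1}=\chi^{\mathrm{rev}}$, where $a^{\mathrm{rev}}_{st}(x)=x^{\rho_{st}}a_{st}(x^{ -1})$). For $s<t$, $\chi_{st}$ is divisible by $x-1$; let $\overline{\chi}_{st}=\chi_{st}/(x-1)$ for $s<t$ and $\overline{\chi}_{ss}=-1$. The $\chi$-Chow function is $\mathrm{H}=-(\overline{\chi})^{ -1}$, and the $\chi$-Chow polynomial of $P$ is $\mathrm{H}_P=\mathrm{H}_{\widehat0\widehat1}$. -}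

module Defs where

open import Data.Nat as ℕ using (ℕ; zero; suc; _∸_)
open import Data.Integer as ℤ using (ℤ; 0ℤ; 1ℤ; -1ℤ)
open import Data.Fin using (Fin; _≟_)
open import Data.List using (List; []; _∷_; [_]; map; foldr; filter; concatMap; replicate; _++_; upTo; allFin)
open import Data.Bool using (Bool; true; false; _∧_; not; if_then_else_)
open import Relation.Binary.PropositionalEquality using (_≡_; _≢_)
open import Relation.Binary.Structures using (IsDecPartialOrder)
open import Relation.Nullary using (does; ¬_)
open import Relation.Nullary.Decidable using (_×-dec_)
open import Data.Product using (_×_; ∃)
open import Data.Sum using (_⊎_)

-- Polynomials in ℤ[x], as coefficient lists (lowest degree first).
-- Two polynomials are equal iff all their coefficients agree
-- (trailing zeros are irrelevant).

Poly : Set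
Poly = List ℤ

coeff : Poly → ℕ → ℤ
coeff []      _       = 0ℤ
coeff (a ∷ p) zero    = a
coeff (a ∷ p) (suc k) = coeff p k

_≈ₚ_ : Poly → Poly → Set
p ≈ₚ q = ∀ k → coeff p k ≡ coeff q k

infixl 6 _+ₚ_
infixl 7 _*ₚ_

_+ₚ_ : Poly → Poly → Poly
[]      +ₚ q       = q
(a ∷ p) +ₚ []      = a ∷ p
(a ∷ p) +ₚ (b ∷ q) = (a ℤ.+ b) ∷ (p +ₚ q)

scaleₚ : ℤ → Poly → Poly
scaleₚ c p = map (c ℤ.*_) p

_*ₚ_ : Poly → Poly → Poly
[]      *ₚ q = []
(a ∷ p) *ₚ q = scaleₚ a q +ₚ (0ℤ ∷ (p *ₚ q))

negₚ : Poly → Poly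
negₚ = map (λ a → ℤ.- a)

constₚ : ℤ → Poly
constₚ c = [ c ]

xpow : ℕ → Poly
xpow k = replicate k 0ℤ ++ [ 1ℤ ]

sumₚ : List Poly → Poly
sumₚ = foldr _+ₚ_ []

prodₚ : List Poly → Poly
prodₚ = foldr _*ₚ_ (constₚ 1ℤ)

sumℤ : List ℤ → ℤ
sumℤ = foldr ℤ._+_ 0ℤ

-- Exact division by (x - 1) (synthetic division): if p = (x-1) q then
-- divX1 p = q, where q_i = -(p_0 + ... + p_i).  Only applied to
-- polynomials divisible by x - 1.
divX1 : Poly → Poly
divX1 = go 0ℤ
  where
  go : ℤ → Poly → Poly
  go acc []           = []
  go acc (a ∷ [])     = []
  go acc (a ∷ b ∷ ps) = ℤ.- (acc ℤ.+ a) ∷ go (acc ℤ.+ a) (b ∷ ps)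

record GradedBoundedPoset (n : ℕ) : Set₁ where
  field
    _≤_        : Fin n → Fin n → Set
    isDecPO    : IsDecPartialOrder _≡_ _≤_
    bot        : Fin n
    top        : Fin n
    bot-min    : ∀ x → bot ≤ x
    top-max    : ∀ x → x ≤ top
    ρ          : Fin n → ℕ
    ρ-bot      : ρ bot ≡ 0
    -- ρ increases by exactly one along covering relations, so that
    -- ρ(w) is the length of any saturated chain from bot to w
    ρ-cover    : ∀ s t → s ≤ t → s ≢ t →
                 (∀ w → s ≤ w → w ≤ t → w ≡ s ⊎ w ≡ t) →
                 ρ t ≡ suc (ρ s)

  open IsDecPartialOrder isDecPO public using (_≤?_)

  ρ[_,_] : Fin n → Fin n → ℕ
  ρ[ s , t ] = ρ t ∸ ρ s

  _<ᵇ_ : Fin n → Fin n → Bool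
  s <ᵇ t = does (s ≤? t) ∧ not (does (s ≟ t))

  interval : Fin n → Fin n → List (Fin n)
  interval s t = filter (λ w → (s ≤? w) ×-dec (w ≤? t)) (allFin n)

  intervalCO : Fin n → Fin n → List (Fin n)
  intervalCO s t = filter (λ w → (s ≤? w) ×-dec ((w ≤? t) ×-dec (Relation.Nullary.Decidable.¬? (w ≟ t)))) (allFin n)
    where import Relation.Nullary.Decidable

  -- Möbius function: μ_ss = 1, μ_st = - Σ_{s ≤ w < t} μ_sw for s < t,
  -- computed by recursion with fuel; fuel n suffices since every strict
  -- chain in P has at most n elements.
  μ' : ℕ → Fin n → Fin n → ℤ
  μ' zero    s t = 0ℤ
  μ' (suc f) s t with does (s ≟ t) | does (s ≤? t)
  ... | true  | _     = 1ℤ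
  ... | false | false = 0ℤ
  ... | false | true  = ℤ.- sumℤ (map (μ' f s) (intervalCO s t))

  μ : Fin n → Fin n → ℤ
  μ = μ' n

  -- Incidence algebra I(P): maps (s,t) ↦ a_st(x) ∈ ℤ[x]; only the
  -- values on intervals s ≤ t are meaningful.
  Inc : Set
  Inc = Fin n → Fin n → Poly

  _⋆_ : Inc → Inc → Inc
  (a ⋆ b) s t = sumₚ (map (λ w → a s w *ₚ b w t) (interval s t))

  δ : Inc
  δ s t = if does (s ≟ t) then constₚ 1ℤ else []

  _≈I_ : Inc → Inc → Set
  a ≈I b = ∀ s t → s ≤ t → a s t ≈ₚ b s t

  IsInverse : Inc → Inc → Set
  IsInverse a b = (a ⋆ b) ≈I δ × (b ⋆ a) ≈I δ

  χ : Inc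
  χ s t = sumₚ (map (λ w → constₚ (μ s w) *ₚ xpow ρ[ w , t ]) (interval s t))

  χ̄ : Inc
  χ̄ s t = if does (s ≟ t) then constₚ -1ℤ else divX1 (χ s t)

  chainFactor : ℕ → Poly
  chainFactor d = divX1 (xpow 1 *ₚ (xpow (d ∸ 1) +ₚ constₚ -1ℤ))

  lists : ℕ → List (List (Fin n))
  lists zero    = [] ∷ []
  lists (suc m) = concatMap (λ x → map (x ∷_) (lists m)) (allFin n)

  isChainFrom : Fin n → List (Fin n) → Bool
  isChainFrom prev []       = does (prev ≤? top)
  isChainFrom prev (p ∷ ps) = (prev <ᵇ p) ∧ isChainFrom p ps

  chainWeight : Fin n → List (Fin n) → Poly
  chainWeight prev []       = constₚ 1ℤ
  chainWeight prev (p ∷ ps) = chainFactor ρ[ prev , p ] *ₚ chainWeight p ps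

  -- chains p1 < ... < pm above bot, m = 0 .. n (longer strict chains
  -- do not exist in an n-element poset)
  chainSum : Poly
  chainSum = sumₚ (concatMap
    (λ m → map (chainWeight bot)
                (filter (λ c → isChainFrom bot c Data.Bool.≟ true) (lists m)))
    (upTo (suc n)))
    where import Data.Bool

{-# OPTIONS --safe #-}
module Submission where

open import Algebra.Bundles using (AbelianGroup; CommutativeRing)
open import Data.Bool using (Bool; true; false; T; _∧_; not; if_then_else_)
import Data.Bool as Bool
open import Data.Bool.Properties using (T-≡; ∧-zeroʳ; ∧-identityʳ; ∧-assoc)
open import Data.Empty using (⊥-elim)
open import Data.Fin using (Fin; zero; suc; _≟_)
open import Data.Fin.Properties using (any?)
open import Data.Fin.Subset using (Subset; _∈_; _⊂_; ∣_∣)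
open import Data.Fin.Subset.Properties using (p⊂q⇒∣p∣<∣q∣; ⊆⊤; ∈⊤; ∣⊤∣≡n)
open import Data.Integer as ℤ using (ℤ; 0ℤ; 1ℤ; -1ℤ)
import Data.Integer.Properties as ℤP
open import Data.Integer.Tactic.RingSolver using () renaming (solve-∀ to ℤ-solve-∀)
open import Data.List as List
  using (List; []; _∷_; _++_; map; concatMap; filter; allFin; upTo; applyUpTo)
import Data.List.Properties as Listₚ
import Data.List.Relation.Unary.All as All
open import Data.List.Relation.Unary.All.Properties using (all-filter)
open import Data.Maybe as Maybe using (Maybe; just; nothing)
open import Data.Nat as ℕ using (ℕ; zero; suc)
import Data.Nat.Properties as ℕₚ
open import Data.Product using (_×_; _,_; proj₁; proj₂)
open import Data.Sum using (_⊎_; inj₁; inj₂)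
open import Data.Unit using (tt)
import Data.Vec as Vec
import Data.Vec.Properties as Vecₚ
open import Data.Vec.Properties using (lookup⇒[]=; []=⇒lookup)
open import Function using (id; _∘_)
open import Function.Bundles using (Equivalence)
open import Level using (0ℓ)
open import Relation.Binary.PropositionalEquality as ≡ using (_≡_; _≢_; cong; cong₂)
import Relation.Binary.Reasoning.Setoid
open import Relation.Binary.Structures using (IsEquivalence; IsDecPartialOrder)
open import Relation.Nullary.Decidable as Dec
  using (Dec; yes; no; does; dec-true; dec-false; does-≡; T?; _×-dec_; ¬?)
open import Relation.Nullary.Negation using (¬_)
open import Relation.Unary using (Pred; Decidable)
open import Tactic.RingSolver using (solve-∀)
open import Tactic.RingSolver.Core.AlmostCommutativeRing
  using (AlmostCommutativeRing; fromCommutativeRing)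

open import Defs

-- Let C(s) be the chain sum of the statement started at s instead of 0̂, so that
-- C(s) = 1 + Σ_{p > s} w(s,p) C(p) with w(s,p) = x (x^{ρ(p)-ρ(s)-1} - 1)/(x - 1).
-- As ρ is strictly monotone, x^{ρ(s,p)} = (x - 1) w(s,p) + x for s < p, whence
-- Σ_{w ≥ u} x^{ρ(u,w)} C(w) = x Σ_{w ≥ u} C(w) + 1 - x.  Since χ = μ x^ρ and μ ζ = δ,
-- applying μ gives Σ_w χ(s,w) C(w) = x C(s) + (1 - x) δ(s,1̂); with (x - 1) χ̄ = χ - x δ
-- and cancelling x - 1 this becomes Σ_w χ̄(s,w) C(w) = -δ(s,1̂).  So -C is the last
-- column of a right inverse of χ̄, and since χ̄ also has a left inverse, C(s) = H(s,1̂).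

-- The ring ℤ[x] of coefficient lists

module Polynomial where

  open ≡ using (refl)

  -- A record rather than _≈ₚ_ itself, so that p and q can be inferred from p ≈ q.
  infix 4 _≈_
  record _≈_ (p q : Poly) : Set where
    constructor mk≈
    field coeff-≈ : p ≈ₚ q
  open _≈_ public

  ≈-isEquivalence : IsEquivalence _≈_
  ≈-isEquivalence = record
    { refl  = mk≈ λ _ → refl
    ; sym   = λ p≈q → mk≈ λ k → ≡.sym (coeff-≈ p≈q k)
    ; trans = λ p≈q q≈r → mk≈ λ k → ≡.trans (coeff-≈ p≈q k) (coeff-≈ q≈r k)
    }

  open IsEquivalence ≈-isEquivalence public renaming (refl to ≈-refl; sym to ≈-sym; trans to ≈-trans)

  cons-≈ : ∀ {a b p q} → a ≡ b → p ≈ q → (a ∷ p) ≈ (b ∷ q)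
  cons-≈ a≡b p≈q = mk≈ λ { zero → a≡b ; (suc k) → coeff-≈ p≈q k }

  coeff-+ : ∀ p q k → coeff (p +ₚ q) k ≡ coeff p k ℤ.+ coeff q k
  coeff-+ []      q       k       = ≡.sym (ℤP.+-identityˡ (coeff q k))
  coeff-+ (a ∷ p) []      k       = ≡.sym (ℤP.+-identityʳ (coeff (a ∷ p) k))
  coeff-+ (a ∷ p) (b ∷ q) zero    = refl
  coeff-+ (a ∷ p) (b ∷ q) (suc k) = coeff-+ p q k

  coeff-scale : ∀ c p k → coeff (scaleₚ c p) k ≡ c ℤ.* coeff p k
  coeff-scale c []      k       = ≡.sym (ℤP.*-zeroʳ c)
  coeff-scale c (a ∷ p) zero    = refl
  coeff-scale c (a ∷ p) (suc k) = coeff-scale c p k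

  coeff-neg : ∀ p k → coeff (negₚ p) k ≡ ℤ.- coeff p k
  coeff-neg []      k       = refl
  coeff-neg (a ∷ p) zero    = refl
  coeff-neg (a ∷ p) (suc k) = coeff-neg p k

  +-cong : ∀ {p p′ q q′} → p ≈ p′ → q ≈ q′ → p +ₚ q ≈ p′ +ₚ q′
  +-cong {p} {p′} {q} {q′} p≈p′ q≈q′ = mk≈ λ k → ≡.trans (coeff-+ p q k)
    (≡.trans (cong₂ ℤ._+_ (coeff-≈ p≈p′ k) (coeff-≈ q≈q′ k)) (≡.sym (coeff-+ p′ q′ k)))

  +-assoc : ∀ p q r → (p +ₚ q) +ₚ r ≈ p +ₚ (q +ₚ r)
  +-assoc p q r = mk≈ λ k → begin
    coeff ((p +ₚ q) +ₚ r) k                  ≡⟨ coeff-+ (p +ₚ q) r k ⟩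
    coeff (p +ₚ q) k ℤ.+ coeff r k           ≡⟨ cong (ℤ._+ coeff r k) (coeff-+ p q k) ⟩
    (coeff p k ℤ.+ coeff q k) ℤ.+ coeff r k  ≡⟨ ℤP.+-assoc (coeff p k) _ _ ⟩
    coeff p k ℤ.+ (coeff q k ℤ.+ coeff r k)  ≡⟨ cong (λ z → coeff p k ℤ.+ z) (coeff-+ q r k) ⟨
    coeff p k ℤ.+ coeff (q +ₚ r) k           ≡⟨ coeff-+ p (q +ₚ r) k ⟨
    coeff (p +ₚ (q +ₚ r)) k                  ∎
    where open ≡.≡-Reasoning

  +-comm : ∀ p q → p +ₚ q ≈ q +ₚ p
  +-comm p q = mk≈ λ k →
    ≡.trans (coeff-+ p q k) (≡.trans (ℤP.+-comm (coeff p k) _) (≡.sym (coeff-+ q p k)))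

  +-identityʳ : ∀ p → p +ₚ [] ≈ p
  +-identityʳ []      = ≈-refl
  +-identityʳ (a ∷ p) = ≈-refl

  -‿cong : ∀ {p q} → p ≈ q → negₚ p ≈ negₚ q
  -‿cong {p} {q} p≈q = mk≈ λ k →
    ≡.trans (coeff-neg p k) (≡.trans (cong ℤ.-_ (coeff-≈ p≈q k)) (≡.sym (coeff-neg q k)))

  -‿inverseʳ : ∀ p → p +ₚ negₚ p ≈ []
  -‿inverseʳ p = mk≈ λ k → ≡.trans (coeff-+ p (negₚ p) k)
    (≡.trans (cong (λ z → coeff p k ℤ.+ z) (coeff-neg p k)) (ℤP.+-inverseʳ (coeff p k)))

  +-abelianGroup : AbelianGroup 0ℓ 0ℓ
  +-abelianGroup = record
    { Carrier = Poly ; _≈_ = _≈_ ; _∙_ = _+ₚ_ ; ε = [] ; _⁻¹ = negₚ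
    ; isAbelianGroup = record
      { isGroup = record
        { isMonoid = record
          { isSemigroup = record
            { isMagma = record { isEquivalence = ≈-isEquivalence ; ∙-cong = +-cong }
            ; assoc = +-assoc }
          ; identity = (λ _ → ≈-refl) , +-identityʳ }
        ; inverse = (λ p → ≈-trans (+-comm (negₚ p) p) (-‿inverseʳ p)) , -‿inverseʳ
        ; ⁻¹-cong = -‿cong }
      ; comm = +-comm } }

  open import Algebra.Properties.CommutativeSemigroup
    (AbelianGroup.commutativeSemigroup +-abelianGroup)
    using (interchange; x∙yz≈y∙xz)

  scale-cong : ∀ c {p q} → p ≈ q → scaleₚ c p ≈ scaleₚ c q
  scale-cong c {p} {q} p≈q = mk≈ λ k →
    ≡.trans (coeff-scale c p k) (≡.trans (cong (c ℤ.*_) (coeff-≈ p≈q k)) (≡.sym (coeff-scale c q k)))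

  scale-zero : ∀ p → scaleₚ 0ℤ p ≈ []
  scale-zero p = mk≈ λ k → ≡.trans (coeff-scale 0ℤ p k) (ℤP.*-zeroˡ (coeff p k))

  scale-one : ∀ p → scaleₚ 1ℤ p ≈ p
  scale-one p = mk≈ λ k → ≡.trans (coeff-scale 1ℤ p k) (ℤP.*-identityˡ (coeff p k))

  scale-distribʳ : ∀ a b p → scaleₚ (a ℤ.+ b) p ≈ scaleₚ a p +ₚ scaleₚ b p
  scale-distribʳ a b p = mk≈ λ k → begin
    coeff (scaleₚ (a ℤ.+ b) p) k                    ≡⟨ coeff-scale (a ℤ.+ b) p k ⟩
    (a ℤ.+ b) ℤ.* coeff p k                         ≡⟨ ℤP.*-distribʳ-+ (coeff p k) a b ⟩
    a ℤ.* coeff p k ℤ.+ b ℤ.* coeff p k             ≡⟨ cong₂ ℤ._+_ (coeff-scale a p k) (coeff-scale b p k) ⟨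
    coeff (scaleₚ a p) k ℤ.+ coeff (scaleₚ b p) k   ≡⟨ coeff-+ (scaleₚ a p) (scaleₚ b p) k ⟨
    coeff (scaleₚ a p +ₚ scaleₚ b p) k              ∎
    where open ≡.≡-Reasoning

  scale-distribˡ : ∀ a p q → scaleₚ a (p +ₚ q) ≈ scaleₚ a p +ₚ scaleₚ a q
  scale-distribˡ a p q = mk≈ λ k → begin
    coeff (scaleₚ a (p +ₚ q)) k                     ≡⟨ coeff-scale a (p +ₚ q) k ⟩
    a ℤ.* coeff (p +ₚ q) k                          ≡⟨ cong (a ℤ.*_) (coeff-+ p q k) ⟩
    a ℤ.* (coeff p k ℤ.+ coeff q k)                 ≡⟨ ℤP.*-distribˡ-+ a (coeff p k) _ ⟩
    a ℤ.* coeff p k ℤ.+ a ℤ.* coeff q k             ≡⟨ cong₂ ℤ._+_ (coeff-scale a p k) (coeff-scale a q k) ⟨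
    coeff (scaleₚ a p) k ℤ.+ coeff (scaleₚ a q) k   ≡⟨ coeff-+ (scaleₚ a p) (scaleₚ a q) k ⟨
    coeff (scaleₚ a p +ₚ scaleₚ a q) k              ∎
    where open ≡.≡-Reasoning

  scale-scale : ∀ a b p → scaleₚ a (scaleₚ b p) ≈ scaleₚ (a ℤ.* b) p
  scale-scale a b p = mk≈ λ k → begin
    coeff (scaleₚ a (scaleₚ b p)) k  ≡⟨ coeff-scale a (scaleₚ b p) k ⟩
    a ℤ.* coeff (scaleₚ b p) k       ≡⟨ cong (a ℤ.*_) (coeff-scale b p k) ⟩
    a ℤ.* (b ℤ.* coeff p k)          ≡⟨ ℤP.*-assoc a b (coeff p k) ⟨
    (a ℤ.* b) ℤ.* coeff p k          ≡⟨ coeff-scale (a ℤ.* b) p k ⟨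
    coeff (scaleₚ (a ℤ.* b) p) k     ∎
    where open ≡.≡-Reasoning

  *-zeroʳ : ∀ p → p *ₚ [] ≈ []
  *-zeroʳ []      = ≈-refl
  *-zeroʳ (a ∷ p) = mk≈ λ { zero → refl ; (suc k) → coeff-≈ (*-zeroʳ p) k }

  *-congʳ : ∀ p {q q′} → q ≈ q′ → p *ₚ q ≈ p *ₚ q′
  *-congʳ []      q≈q′ = ≈-refl
  *-congʳ (a ∷ p) q≈q′ = +-cong (scale-cong a q≈q′) (cons-≈ refl (*-congʳ p q≈q′))

  *-consʳ : ∀ p b q → p *ₚ (b ∷ q) ≈ scaleₚ b p +ₚ (0ℤ ∷ p *ₚ q)
  *-consʳ []      b q = mk≈ λ { zero → refl ; (suc k) → refl }
  *-consʳ (a ∷ p) b q = cons-≈ (cong (ℤ._+ 0ℤ) (ℤP.*-comm a b))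
    (≈-trans (+-cong (≈-refl {scaleₚ a q}) (*-consʳ p b q)) (x∙yz≈y∙xz (scaleₚ a q) (scaleₚ b p) _))

  *-comm : ∀ p q → p *ₚ q ≈ q *ₚ p
  *-comm []      q = ≈-sym (*-zeroʳ q)
  *-comm (a ∷ p) q = ≈-trans (+-cong ≈-refl (cons-≈ refl (*-comm p q))) (≈-sym (*-consʳ q a p))

  *-cong : ∀ {p p′ q q′} → p ≈ p′ → q ≈ q′ → p *ₚ q ≈ p′ *ₚ q′
  *-cong {p} {p′} {q} {q′} p≈p′ q≈q′ = ≈-trans (*-congʳ p q≈q′)
    (≈-trans (*-comm p q′) (≈-trans (*-congʳ q′ p≈p′) (*-comm q′ p′)))

  *-distribʳ : ∀ r p q → (p +ₚ q) *ₚ r ≈ p *ₚ r +ₚ q *ₚ r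
  *-distribʳ r []      q       = ≈-refl
  *-distribʳ r (a ∷ p) []      = ≈-sym (+-identityʳ _)
  *-distribʳ r (a ∷ p) (b ∷ q) =
    ≈-trans (+-cong (scale-distribʳ a b r) (cons-≈ refl (*-distribʳ r p q)))
            (interchange (scaleₚ a r) (scaleₚ b r) (0ℤ ∷ p *ₚ r) (0ℤ ∷ q *ₚ r))

  *-distribˡ : ∀ r p q → r *ₚ (p +ₚ q) ≈ r *ₚ p +ₚ r *ₚ q
  *-distribˡ r p q = ≈-trans (*-comm r (p +ₚ q))
    (≈-trans (*-distribʳ r p q) (+-cong (*-comm p r) (*-comm q r)))

  scale-*ˡ : ∀ a q r → scaleₚ a q *ₚ r ≈ scaleₚ a (q *ₚ r)
  scale-*ˡ a []      r = ≈-refl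
  scale-*ˡ a (b ∷ q) r = ≈-trans
    (+-cong (≈-sym (scale-scale a b r)) (cons-≈ (≡.sym (ℤP.*-zeroʳ a)) (scale-*ˡ a q r)))
    (≈-sym (scale-distribˡ a (scaleₚ b r) (0ℤ ∷ q *ₚ r)))

  *-assoc : ∀ p q r → (p *ₚ q) *ₚ r ≈ p *ₚ (q *ₚ r)
  *-assoc []      q r = ≈-refl
  *-assoc (a ∷ p) q r = ≈-trans (*-distribʳ r (scaleₚ a q) (0ℤ ∷ p *ₚ q))
    (+-cong (scale-*ˡ a q r) (+-cong (scale-zero r) (cons-≈ refl (*-assoc p q r))))

  *-identityˡ : ∀ p → constₚ 1ℤ *ₚ p ≈ p
  *-identityˡ p = ≈-trans (+-cong (scale-one p) (mk≈ λ { zero → refl ; (suc k) → refl }))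
                          (+-identityʳ p)

  commutativeRing : CommutativeRing 0ℓ 0ℓ
  commutativeRing = record
    { Carrier = Poly ; _≈_ = _≈_ ; _+_ = _+ₚ_ ; _*_ = _*ₚ_ ; -_ = negₚ ; 0# = [] ; 1# = constₚ 1ℤ
    ; isCommutativeRing = record
      { isRing = record
        { +-isAbelianGroup = AbelianGroup.isAbelianGroup +-abelianGroup
        ; *-cong = *-cong
        ; *-assoc = *-assoc
        ; *-identity = *-identityˡ , λ p → ≈-trans (*-comm p _) (*-identityˡ p)
        ; distrib = *-distribˡ , *-distribʳ }
      ; *-comm = *-comm } }

  almostCommutativeRing : AlmostCommutativeRing 0ℓ 0ℓ
  almostCommutativeRing = fromCommutativeRing commutativeRing 0≟_
    where
    -- The solver discards exactly those coefficients that this test proves zero.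
    0≟_ : ∀ p → Maybe ([] ≈ p)
    0≟ []      = just ≈-refl
    0≟ (a ∷ p) with 0ℤ ℤ.≟ a
    ... | yes 0≡a = Maybe.map (λ 0≈p → mk≈ λ { zero → 0≡a ; (suc k) → coeff-≈ 0≈p k }) (0≟ p)
    ... | no _    = nothing

open Polynomial
  using (_≈_; mk≈; coeff-≈; cons-≈; scale-zero; commutativeRing; almostCommutativeRing)

-- Notation from the solver's ring; its _-_ is left out, as lacking a fixity
-- declaration it binds tighter than _*_.
open AlmostCommutativeRing almostCommutativeRing
  using ( _+_; _*_; -_; 0#; 1#; setoid; refl; sym; trans; reflexive
        ; +-cong; +-congˡ; +-congʳ; *-cong; *-congˡ; *-congʳ; -‿cong
        ; +-assoc; +-identityˡ; +-identityʳ; *-assoc; *-comm; *-identityˡ; *-identityʳ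
        ; zeroˡ; zeroʳ; distribˡ; distribʳ )
module ≈-Reasoning = Relation.Binary.Reasoning.Setoid setoid

open import Algebra.Properties.Semiring.Sum (CommutativeRing.semiring commutativeRing)
  using (sum; sum-cong-≋; sum-replicate-zero; ∑-distrib-+; ∑-comm; *-distribˡ-sum)
open import Algebra.Properties.CommutativeSemigroup ℤP.+-commutativeSemigroup
  using () renaming (interchange to ℤ-interchange)

X : Poly
X = xpow 1

X*≈0∷ : ∀ q → X * q ≈ 0ℤ ∷ q
X*≈0∷ q = +-cong (scale-zero q) (cons-≈ ≡.refl (*-identityˡ q))

∷≈ : ∀ c q → c ∷ q ≈ constₚ c + X * q
∷≈ c q = sym (begin
  constₚ c + X * q     ≈⟨ +-congˡ {x = constₚ c} (X*≈0∷ q) ⟩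
  constₚ c + (0ℤ ∷ q)  ≈⟨ cons-≈ (ℤP.+-identityʳ c) refl ⟩
  c ∷ q                ∎)
  where open ≈-Reasoning

-- Evaluation at 1 and division by x - 1

[X-1]*∷ : ∀ c q → (X + - 1#) * (c ∷ q) ≈ (ℤ.- c) ∷ (constₚ c + (X + - 1#) * q)
[X-1]*∷ c q = begin
  (X + - 1#) * (c ∷ q)                          ≈⟨ *-congˡ {x = X + - 1#} (∷≈ c q) ⟩
  (X + - 1#) * (constₚ c + X * q)               ≈⟨ identity X (constₚ c) q ⟩
  - constₚ c + X * (constₚ c + (X + - 1#) * q)  ≈⟨ ∷≈ (ℤ.- c) (constₚ c + (X + - 1#) * q) ⟨
  (ℤ.- c) ∷ (constₚ c + (X + - 1#) * q)         ∎
  where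
  open ≈-Reasoning
  identity : ∀ x C q → (x + - 1#) * (C + x * q) ≈ - C + x * (C + (x + - 1#) * q)
  identity = solve-∀ almostCommutativeRing

eval₁ : Poly → ℤ
eval₁ = sumℤ

eval₁-+ : ∀ p q → eval₁ (p + q) ≡ eval₁ p ℤ.+ eval₁ q
eval₁-+ []      q       = ≡.sym (ℤP.+-identityˡ (eval₁ q))
eval₁-+ (a ∷ p) []      = ≡.sym (ℤP.+-identityʳ (eval₁ (a ∷ p)))
eval₁-+ (a ∷ p) (b ∷ q) =
  ≡.trans (cong (λ z → (a ℤ.+ b) ℤ.+ z) (eval₁-+ p q)) (ℤ-interchange a b (eval₁ p) (eval₁ q))

eval₁-scale : ∀ c p → eval₁ (scaleₚ c p) ≡ c ℤ.* eval₁ p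
eval₁-scale c []      = ≡.sym (ℤP.*-zeroʳ c)
eval₁-scale c (a ∷ p) =
  ≡.trans (cong (λ z → c ℤ.* a ℤ.+ z) (eval₁-scale c p)) (≡.sym (ℤP.*-distribˡ-+ c a (eval₁ p)))

eval₁-* : ∀ p q → eval₁ (p * q) ≡ eval₁ p ℤ.* eval₁ q
eval₁-* []      q = ≡.refl
eval₁-* (a ∷ p) q = begin
  eval₁ (scaleₚ a q + (0ℤ ∷ p * q))              ≡⟨ eval₁-+ (scaleₚ a q) (0ℤ ∷ p * q) ⟩
  eval₁ (scaleₚ a q) ℤ.+ (0ℤ ℤ.+ eval₁ (p * q))  ≡⟨ cong₂ ℤ._+_ (eval₁-scale a q) (ℤP.+-identityˡ _) ⟩
  a ℤ.* eval₁ q ℤ.+ eval₁ (p * q)                ≡⟨ cong (λ z → a ℤ.* eval₁ q ℤ.+ z) (eval₁-* p q) ⟩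
  a ℤ.* eval₁ q ℤ.+ eval₁ p ℤ.* eval₁ q          ≡⟨ ℤP.*-distribʳ-+ (eval₁ q) a (eval₁ p) ⟨
  (a ℤ.+ eval₁ p) ℤ.* eval₁ q                    ∎
  where open ≡.≡-Reasoning

eval₁-cong : ∀ {p q} → p ≈ q → eval₁ p ≡ eval₁ q
eval₁-cong {[]}    {[]}    p≈q = ≡.refl
eval₁-cong {[]}    {b ∷ q} p≈q =
  cong₂ ℤ._+_ (coeff-≈ p≈q 0) (eval₁-cong {[]} {q} (mk≈ λ k → coeff-≈ p≈q (suc k)))
eval₁-cong {a ∷ p} {[]}    p≈q =
  cong₂ ℤ._+_ (coeff-≈ p≈q 0) (eval₁-cong {p} {[]} (mk≈ λ k → coeff-≈ p≈q (suc k)))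
eval₁-cong {a ∷ p} {b ∷ q} p≈q =
  cong₂ ℤ._+_ (coeff-≈ p≈q 0) (eval₁-cong {p} {q} (mk≈ λ k → coeff-≈ p≈q (suc k)))

eval₁-xpow : ∀ k → eval₁ (xpow k) ≡ 1ℤ
eval₁-xpow zero    = ≡.refl
eval₁-xpow (suc k) = ≡.trans (ℤP.+-identityˡ _) (eval₁-xpow k)

eval₁-*-xpow : ∀ c k → eval₁ (c * xpow k) ≡ eval₁ (c * 1#)
eval₁-*-xpow c k = ≡.trans (eval₁-* c (xpow k))
  (≡.trans (cong (eval₁ c ℤ.*_) (eval₁-xpow k)) (≡.sym (eval₁-* c 1#)))

eval₁-sumₚ-cong : ∀ {A : Set} {f g : A → Poly} xs → (∀ x → eval₁ (f x) ≡ eval₁ (g x)) →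
                  eval₁ (sumₚ (map f xs)) ≡ eval₁ (sumₚ (map g xs))
eval₁-sumₚ-cong []       _  = ≡.refl
eval₁-sumₚ-cong {f = f} {g} (x ∷ xs) fx≡gx = begin
  eval₁ (f x + sumₚ (map f xs))            ≡⟨ eval₁-+ (f x) _ ⟩
  eval₁ (f x) ℤ.+ eval₁ (sumₚ (map f xs))  ≡⟨ cong₂ ℤ._+_ (fx≡gx x) (eval₁-sumₚ-cong xs fx≡gx) ⟩
  eval₁ (g x) ℤ.+ eval₁ (sumₚ (map g xs))  ≡⟨ eval₁-+ (g x) _ ⟨
  eval₁ (g x + sumₚ (map g xs))            ∎
  where open ≡.≡-Reasoning

-- divX1 runs a local function with accumulator 0ℤ; splitting a makes 0ℤ + a compute.
divX1-∷∷ : ∀ a b ps → divX1 (a ∷ b ∷ ps) ≡ (ℤ.- a) ∷ divX1 ((a ℤ.+ b) ∷ ps)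
divX1-∷∷ (ℤ.+ k)    b []       = ≡.refl
divX1-∷∷ ℤ.-[1+ k ] b []       = ≡.refl
divX1-∷∷ (ℤ.+ k)    b (c ∷ ps) rewrite ℤP.+-identityˡ (ℤ.+ k ℤ.+ b)    = ≡.refl
divX1-∷∷ ℤ.-[1+ k ] b (c ∷ ps) rewrite ℤP.+-identityˡ (ℤ.-[1+ k ] ℤ.+ b) = ≡.refl

divX1-∷-correct : ∀ a ps → eval₁ (a ∷ ps) ≡ 0ℤ → (X + - 1#) * divX1 (a ∷ ps) ≈ a ∷ ps
divX1-∷-correct a []       a+0≡0 = trans (zeroʳ (X + - 1#)) (mk≈ λ
  { zero    → ≡.trans (≡.sym a+0≡0) (ℤP.+-identityʳ a)
  ; (suc k) → ≡.refl })
divX1-∷-correct a (b ∷ ps) sum≡0 = begin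
  (X + - 1#) * divX1 (a ∷ b ∷ ps)                  ≡⟨ cong ((X + - 1#) *_) (divX1-∷∷ a b ps) ⟩
  (X + - 1#) * ((ℤ.- a) ∷ q)                       ≈⟨ [X-1]*∷ (ℤ.- a) q ⟩
  (ℤ.- ℤ.- a) ∷ (constₚ (ℤ.- a) + (X + - 1#) * q)  ≈⟨ cons-≈ (ℤP.neg-involutive a)
                                                               (+-congˡ {x = constₚ (ℤ.- a)} IH) ⟩
  a ∷ (constₚ (ℤ.- a) + ((a ℤ.+ b) ∷ ps))          ≈⟨ cons-≈ ≡.refl (cons-≈ (-a+[a+b]≡b a b) refl) ⟩
  a ∷ b ∷ ps                                       ∎
  where
  open ≈-Reasoning
  q = divX1 ((a ℤ.+ b) ∷ ps)
  IH : (X + - 1#) * q ≈ (a ℤ.+ b) ∷ ps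
  IH = divX1-∷-correct (a ℤ.+ b) ps (≡.trans (ℤP.+-assoc a b (eval₁ ps)) sum≡0)
  -a+[a+b]≡b : ∀ a b → ℤ.- a ℤ.+ (a ℤ.+ b) ≡ b
  -a+[a+b]≡b = ℤ-solve-∀

divX1-correct : ∀ p → eval₁ p ≡ 0ℤ → (X + - 1#) * divX1 p ≈ p
divX1-correct []       _ = zeroʳ (X + - 1#)
divX1-correct (a ∷ ps)   = divX1-∷-correct a ps

[X-1]*≈0⇒≈0 : ∀ r → (X + - 1#) * r ≈ 0# → r ≈ 0#
[X-1]*≈0⇒≈0 r [X-1]r≈0 = mk≈ vanish
  where
  r≈0∷r : r ≈ 0ℤ ∷ r
  r≈0∷r = begin
    r                           ≈⟨ identity X r ⟩
    X * r + - ((X + - 1#) * r)  ≈⟨ +-cong (X*≈0∷ r) (-‿cong [X-1]r≈0) ⟩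
    0ℤ ∷ r                      ∎
    where
    open ≈-Reasoning
    identity : ∀ x y → y ≈ x * y + - ((x + - 1#) * y)
    identity = solve-∀ almostCommutativeRing
  vanish : ∀ k → coeff r k ≡ 0ℤ
  vanish zero    = coeff-≈ r≈0∷r zero
  vanish (suc k) = ≡.trans (coeff-≈ r≈0∷r (suc k)) (vanish k)

[X-1]*-cancelˡ : ∀ p q → (X + - 1#) * p ≈ (X + - 1#) * q → p ≈ q
[X-1]*-cancelˡ p q [X-1]p≈[X-1]q = begin
  p              ≈⟨ split p q ⟩
  (p + - q) + q  ≈⟨ +-congʳ ([X-1]*≈0⇒≈0 (p + - q) [X-1][p-q]≈0) ⟩
  0# + q         ≈⟨ +-identityˡ q ⟩
  q              ∎
  where
  open ≈-Reasoning
  split : ∀ p q → p ≈ (p + - q) + q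
  split = solve-∀ almostCommutativeRing
  distrib : ∀ x p q → x * (p + - q) ≈ x * p + - (x * q)
  distrib = solve-∀ almostCommutativeRing
  cancel : ∀ a → a + - a ≈ 0#
  cancel = solve-∀ almostCommutativeRing
  [X-1][p-q]≈0 : (X + - 1#) * (p + - q) ≈ 0#
  [X-1][p-q]≈0 = begin
    (X + - 1#) * (p + - q)               ≈⟨ distrib (X + - 1#) p q ⟩
    (X + - 1#) * p + - ((X + - 1#) * q)  ≈⟨ +-congʳ [X-1]p≈[X-1]q ⟩
    (X + - 1#) * q + - ((X + - 1#) * q)  ≈⟨ cancel ((X + - 1#) * q) ⟩
    0#                                   ∎

T-does⁻ : ∀ {A : Set} (a? : Dec A) → T (does a?) → A
T-does⁻ (yes a) _ = a

T-does⁺ : ∀ {A : Set} (a? : Dec A) → A → T (does a?)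
T-does⁺ (yes _) _ = tt
T-does⁺ (no ¬a) a = ¬a a

T-not-does⁻ : ∀ {A : Set} (a? : Dec A) → T (not (does a?)) → ¬ A
T-not-does⁻ (no ¬a) _ = ¬a

T-not-does⁺ : ∀ {A : Set} (a? : Dec A) → ¬ A → T (not (does a?))
T-not-does⁺ (yes a) ¬a = ¬a a
T-not-does⁺ (no _)  _  = tt

T-∧⁻ : ∀ a {b} → T (a ∧ b) → T a × T b
T-∧⁻ true t = tt , t

T-∧⁺ : ∀ {a b} → T a → T b → T (a ∧ b)
T-∧⁺ {true} _ t = t

does-≟-true : ∀ b → does (b Bool.≟ true) ≡ b
does-≟-true true  = ≡.refl
does-≟-true false = ≡.refl

_≟ᵇ_ : ∀ {m} → Fin m → Fin m → Bool
w ≟ᵇ u = does (w ≟ u)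

≟ᵇ-sym : ∀ {m} (w u : Fin m) → w ≟ᵇ u ≡ u ≟ᵇ w
≟ᵇ-sym w u = does-≡ (w ≟ u) (Dec.map′ ≡.sym ≡.sym (u ≟ w))

∧-absorb : ∀ a b c → (T a → T b → T c) → c ∧ (a ∧ b) ≡ a ∧ b
∧-absorb true  true  true  _   = ≡.refl
∧-absorb true  true  false a⇒c = ⊥-elim (a⇒c tt tt)
∧-absorb true  false c     _   = ∧-zeroʳ c
∧-absorb false b     c     _   = ∧-zeroʳ c

⟦_⟧ : Bool → Poly
⟦ b ⟧ = if b then 1# else 0#

⟦∧⟧ : ∀ a b → ⟦ a ∧ b ⟧ ≈ ⟦ a ⟧ * ⟦ b ⟧
⟦∧⟧ true  b = sym (*-identityˡ ⟦ b ⟧)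
⟦∧⟧ false b = sym (zeroˡ ⟦ b ⟧)

⟦⟧-absorb : ∀ a b → (T b → T a) → ⟦ a ⟧ * ⟦ b ⟧ ≈ ⟦ b ⟧
⟦⟧-absorb true  b     _   = *-identityˡ ⟦ b ⟧
⟦⟧-absorb false false _   = zeroˡ 0#
⟦⟧-absorb false true  b⇒a = ⊥-elim (b⇒a tt)

⟦⟧-split : ∀ a b → (T b → T a) → ⟦ a ⟧ ≈ ⟦ b ⟧ + ⟦ a ∧ not b ⟧
⟦⟧-split true  true  _   = sym (+-identityʳ 1#)
⟦⟧-split true  false _   = sym (+-identityˡ 1#)
⟦⟧-split false false _   = sym (+-identityˡ 0#)
⟦⟧-split false true  b⇒a = ⊥-elim (b⇒a tt)

⟦⟧*-cong : ∀ b {p q} → (T b → p ≈ q) → ⟦ b ⟧ * p ≈ ⟦ b ⟧ * q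
⟦⟧*-cong true  p≈q = *-congˡ {x = 1#} (p≈q tt)
⟦⟧*-cong false {p} {q} _ = trans (zeroˡ p) (sym (zeroˡ q))

sumₚ-++ : ∀ ps qs → sumₚ (ps ++ qs) ≈ sumₚ ps + sumₚ qs
sumₚ-++ []       qs = sym (+-identityˡ (sumₚ qs))
sumₚ-++ (p ∷ ps) qs = trans (+-congˡ {x = p} (sumₚ-++ ps qs)) (sym (+-assoc p (sumₚ ps) (sumₚ qs)))

sumₚ-concatMap : ∀ {A : Set} (f : A → List Poly) xs → sumₚ (concatMap f xs) ≈ sumₚ (map (sumₚ ∘ f) xs)
sumₚ-concatMap f []       = refl
sumₚ-concatMap f (x ∷ xs) =
  trans (sumₚ-++ (f x) (concatMap f xs)) (+-congˡ {x = sumₚ (f x)} (sumₚ-concatMap f xs))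

sumₚ-map-concatMap : ∀ {A B : Set} (g : B → Poly) (f : A → List B) xs →
                     sumₚ (map g (concatMap f xs)) ≈ sumₚ (map (λ x → sumₚ (map g (f x))) xs)
sumₚ-map-concatMap g f []       = refl
sumₚ-map-concatMap g f (x ∷ xs) = begin
  sumₚ (map g (f x ++ concatMap f xs))
    ≡⟨ cong sumₚ (Listₚ.map-++ g (f x) (concatMap f xs)) ⟩
  sumₚ (map g (f x) ++ map g (concatMap f xs))
    ≈⟨ sumₚ-++ (map g (f x)) (map g (concatMap f xs)) ⟩
  sumₚ (map g (f x)) + sumₚ (map g (concatMap f xs))
    ≈⟨ +-congˡ {x = sumₚ (map g (f x))} (sumₚ-map-concatMap g f xs) ⟩
  sumₚ (map g (f x)) + sumₚ (map (λ y → sumₚ (map g (f y))) xs)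
    ∎
  where open ≈-Reasoning

constₚ-sumℤ : ∀ {A : Set} (f : A → ℤ) xs → constₚ (sumℤ (map f xs)) ≈ sumₚ (map (constₚ ∘ f) xs)
constₚ-sumℤ f []       = mk≈ λ { zero → ≡.refl ; (suc k) → ≡.refl }
constₚ-sumℤ f (x ∷ xs) = +-congˡ {x = constₚ (f x)} (constₚ-sumℤ f xs)

sumₚ-map-cong : ∀ {A : Set} {f g : A → Poly} xs → (∀ x → f x ≈ g x) →
                sumₚ (map f xs) ≈ sumₚ (map g xs)
sumₚ-map-cong []       f≈g = refl
sumₚ-map-cong (x ∷ xs) f≈g = +-cong (f≈g x) (sumₚ-map-cong xs f≈g)

sumₚ-map-* : ∀ {A : Set} p (g : A → Poly) xs → sumₚ (map (λ x → p * g x) xs) ≈ p * sumₚ (map g xs)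
sumₚ-map-* p g []       = sym (zeroʳ p)
sumₚ-map-* p g (x ∷ xs) =
  trans (+-congˡ {x = p * g x} (sumₚ-map-* p g xs)) (sym (distribˡ p (g x) (sumₚ (map g xs))))

sumₚ-map-filter : ∀ {A : Set} {ℓ} {P : Pred A ℓ} (P? : Decidable P) (g : A → Poly) xs →
                  sumₚ (map g (filter P? xs)) ≈ sumₚ (map (λ x → ⟦ does (P? x) ⟧ * g x) xs)
sumₚ-map-filter P? g []       = refl
sumₚ-map-filter P? g (x ∷ xs) with does (P? x)
... | true  = +-cong (sym (*-identityˡ (g x))) (sumₚ-map-filter P? g xs)
... | false = trans (sumₚ-map-filter P? g xs) (sym (trans (+-congʳ (zeroˡ (g x))) (+-identityˡ _)))

sumₚ-tabulate : ∀ {m} (g : Fin m → Poly) → sumₚ (List.tabulate g) ≡ sum g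
sumₚ-tabulate {zero}  g = ≡.refl
sumₚ-tabulate {suc m} g = cong (g zero +_) (sumₚ-tabulate (g ∘ suc))

-- Opaque, so that b and g can be inferred by unification from ∑⟨ b ⟩ g.
opaque
  ∑⟨_⟩_ : ∀ {m} → (Fin m → Bool) → (Fin m → Poly) → Poly
  ∑⟨ b ⟩ g = sum (λ u → ⟦ b u ⟧ * g u)

opaque
  unfolding ∑⟨_⟩_

  ∑⟨⟩-cong : ∀ {m} {b} {g h : Fin m → Poly} → (∀ u → T (b u) → g u ≈ h u) →
             ∑⟨ b ⟩ g ≈ ∑⟨ b ⟩ h
  ∑⟨⟩-cong {b = b} g≈h = sum-cong-≋ (λ u → ⟦⟧*-cong (b u) (g≈h u))

  ∑⟨⟩-guard : ∀ {m} {b c} (g : Fin m → Poly) → (∀ u → b u ≡ c u) → ∑⟨ b ⟩ g ≈ ∑⟨ c ⟩ g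
  ∑⟨⟩-guard g b≡c = sum-cong-≋ (λ u → reflexive (cong (λ z → ⟦ z ⟧ * g u) (b≡c u)))

  ∑⟨⟩-+ : ∀ {m} b (g h : Fin m → Poly) → ∑⟨ b ⟩ (λ u → g u + h u) ≈ ∑⟨ b ⟩ g + ∑⟨ b ⟩ h
  ∑⟨⟩-+ b g h = trans (sum-cong-≋ (λ u → distribˡ ⟦ b u ⟧ (g u) (h u)))
                      (∑-distrib-+ (λ u → ⟦ b u ⟧ * g u) (λ u → ⟦ b u ⟧ * h u))

  ∑⟨⟩-* : ∀ {m} b p (g : Fin m → Poly) → ∑⟨ b ⟩ (λ u → p * g u) ≈ p * ∑⟨ b ⟩ g
  ∑⟨⟩-* b p g = trans (sum-cong-≋ (λ u → x*yz≈y*xz ⟦ b u ⟧ p (g u)))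
                      (sym (*-distribˡ-sum p (λ u → ⟦ b u ⟧ * g u)))
    where
    x*yz≈y*xz : ∀ x y z → x * (y * z) ≈ y * (x * z)
    x*yz≈y*xz = solve-∀ almostCommutativeRing

  ∑⟨⟩-zero : ∀ {m} b (g : Fin m → Poly) → (∀ u → T (b u) → g u ≈ 0#) → ∑⟨ b ⟩ g ≈ 0#
  ∑⟨⟩-zero {m} b g g≈0 = begin
    ∑⟨ b ⟩ g              ≈⟨ ∑⟨⟩-cong {b = b} {g} {λ _ → 0#} g≈0 ⟩
    ∑⟨ b ⟩ (λ _ → 0#)     ≈⟨ sum-cong-≋ {m} (λ u → zeroʳ ⟦ b u ⟧) ⟩
    sum {m} (λ _ → 0#)    ≈⟨ sum-replicate-zero m ⟩
    0#                    ∎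
    where open ≈-Reasoning

  ∑-δ : ∀ {m} (w : Fin m) g → ∑⟨ w ≟ᵇ_ ⟩ g ≈ g w
  ∑-δ zero    g = trans
    (+-cong (*-identityˡ (g zero)) (∑⟨⟩-zero (λ u → zero ≟ᵇ suc u) (g ∘ suc) (λ _ ())))
    (+-identityʳ (g zero))
  ∑-δ (suc w) g = trans (+-cong (zeroˡ (g zero)) (∑-δ w (g ∘ suc))) (+-identityˡ (g (suc w)))

  ∑⟨⟩-split : ∀ {m} (b : Fin m → Bool) w g → T (b w) →
              ∑⟨ b ⟩ g ≈ g w + ∑⟨ (λ u → b u ∧ not (w ≟ᵇ u)) ⟩ g
  ∑⟨⟩-split {m} b w g bw = begin
    ∑⟨ b ⟩ g
      ≈⟨ sum-cong-≋ (λ u → *-congʳ {x = g u} (⟦⟧-split (b u) (w ≟ᵇ u) (at-w u))) ⟩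
    sum (λ u → (⟦ w ≟ᵇ u ⟧ + ⟦ b′ u ⟧) * g u)
      ≈⟨ sum-cong-≋ (λ u → distribʳ (g u) ⟦ w ≟ᵇ u ⟧ ⟦ b′ u ⟧) ⟩
    sum (λ u → ⟦ w ≟ᵇ u ⟧ * g u + ⟦ b′ u ⟧ * g u)
      ≈⟨ ∑-distrib-+ (λ u → ⟦ w ≟ᵇ u ⟧ * g u) (λ u → ⟦ b′ u ⟧ * g u) ⟩
    ∑⟨ w ≟ᵇ_ ⟩ g + ∑⟨ b′ ⟩ g
      ≈⟨ +-congʳ (∑-δ w g) ⟩
    g w + ∑⟨ b′ ⟩ g
      ∎
    where
    open ≈-Reasoning
    b′ : Fin m → Bool
    b′ u = b u ∧ not (w ≟ᵇ u)
    at-w : ∀ u → T (w ≟ᵇ u) → T (b u)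
    at-w u w≡u = ≡.subst (T ∘ b) (T-does⁻ (w ≟ u) w≡u) bw

  ∑⟨⟩-swap : ∀ {m m′} (b : Fin m → Bool) (c : Fin m → Fin m′ → Bool)
               (b′ : Fin m′ → Bool) (c′ : Fin m′ → Fin m → Bool) (f : Fin m → Fin m′ → Poly) →
             (∀ w u → b w ∧ c w u ≡ b′ u ∧ c′ u w) →
             ∑⟨ b ⟩ (λ w → ∑⟨ c w ⟩ (f w)) ≈ ∑⟨ b′ ⟩ (λ u → ∑⟨ c′ u ⟩ (λ w → f w u))
  ∑⟨⟩-swap b c b′ c′ f guards≡ = begin
    sum (λ w → ⟦ b w ⟧ * sum (λ u → ⟦ c w u ⟧ * f w u))
      ≈⟨ sum-cong-≋ (λ w → guard-in (b w) (c w) (f w)) ⟩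
    sum (λ w → sum (λ u → ⟦ b w ∧ c w u ⟧ * f w u))
      ≈⟨ sum-cong-≋ (λ w → sum-cong-≋ (λ u → reflexive (cong (λ z → ⟦ z ⟧ * f w u) (guards≡ w u)))) ⟩
    sum (λ w → sum (λ u → ⟦ b′ u ∧ c′ u w ⟧ * f w u))
      ≈⟨ ∑-comm (λ w u → ⟦ b′ u ∧ c′ u w ⟧ * f w u) ⟩
    sum (λ u → sum (λ w → ⟦ b′ u ∧ c′ u w ⟧ * f w u))
      ≈⟨ sum-cong-≋ (λ u → guard-in (b′ u) (c′ u) (λ w → f w u)) ⟨
    sum (λ u → ⟦ b′ u ⟧ * sum (λ w → ⟦ c′ u w ⟧ * f w u))
      ∎
    where
    open ≈-Reasoning
    guard-in : ∀ {k} a (c : Fin k → Bool) (g : Fin k → Poly) →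
               ⟦ a ⟧ * sum (λ u → ⟦ c u ⟧ * g u) ≈ sum (λ u → ⟦ a ∧ c u ⟧ * g u)
    guard-in a c g = trans (*-distribˡ-sum ⟦ a ⟧ (λ u → ⟦ c u ⟧ * g u))
      (sum-cong-≋ (λ u → trans (sym (*-assoc ⟦ a ⟧ ⟦ c u ⟧ (g u))) (*-congʳ (sym (⟦∧⟧ a (c u))))))

  ∑⟨⟩-restrict : ∀ {m} (b c : Fin m → Bool) (g : Fin m → Poly) → (∀ u → T (c u) → T (b u)) →
                 ∑⟨ b ⟩ (λ u → ⟦ c u ⟧ * g u) ≈ ∑⟨ c ⟩ g
  ∑⟨⟩-restrict b c g c⇒b = sum-cong-≋ (λ u →
    trans (sym (*-assoc ⟦ b u ⟧ ⟦ c u ⟧ (g u))) (*-congʳ {x = g u} (⟦⟧-absorb (b u) (c u) (c⇒b u))))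

  sumₚ-allFin : ∀ {m} (b : Fin m → Bool) (g : Fin m → Poly) →
                sumₚ (map (λ u → ⟦ b u ⟧ * g u) (allFin m)) ≡ ∑⟨ b ⟩ g
  sumₚ-allFin b g = ≡.trans (cong sumₚ (Listₚ.map-tabulate id (λ u → ⟦ b u ⟧ * g u)))
                            (sumₚ-tabulate (λ u → ⟦ b u ⟧ * g u))

sumₚ-filter-allFin : ∀ {m ℓ} {P : Pred (Fin m) ℓ} (P? : Decidable P) (g : Fin m → Poly) →
                     sumₚ (map g (filter P? (allFin m))) ≈ ∑⟨ (λ u → does (P? u)) ⟩ g
sumₚ-filter-allFin {m} P? g =
  trans (sumₚ-map-filter P? g (allFin m)) (reflexive (sumₚ-allFin (λ u → does (P? u)) g))

∑⟨⟩-*ʳ : ∀ {m} b p (g : Fin m → Poly) → ∑⟨ b ⟩ (λ u → g u * p) ≈ ∑⟨ b ⟩ g * p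
∑⟨⟩-*ʳ b p g = trans (∑⟨⟩-cong (λ u _ → *-comm (g u) p)) (trans (∑⟨⟩-* b p g) (*-comm p (∑⟨ b ⟩ g)))

∑⟨⟩-linear : ∀ {m} b p q (g h : Fin m → Poly) →
             ∑⟨ b ⟩ (λ u → p * g u + q * h u) ≈ p * ∑⟨ b ⟩ g + q * ∑⟨ b ⟩ h
∑⟨⟩-linear b p q g h =
  trans (∑⟨⟩-+ b (λ u → p * g u) (λ u → q * h u)) (+-cong (∑⟨⟩-* b p g) (∑⟨⟩-* b q h))

sumₚ-∑⟨⟩ : ∀ {A : Set} {m} (b : Fin m → Bool) (f : Fin m → Poly) (g : A → Fin m → Poly) xs →
           sumₚ (map (λ x → ∑⟨ b ⟩ (λ u → f u * g x u)) xs) ≈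
           ∑⟨ b ⟩ (λ u → f u * sumₚ (map (λ x → g x u) xs))
sumₚ-∑⟨⟩ b f g []       = sym (∑⟨⟩-zero b (λ u → f u * 0#) (λ u _ → zeroʳ (f u)))
sumₚ-∑⟨⟩ b f g (x ∷ xs) = begin
  ∑⟨ b ⟩ (λ u → f u * g x u) + sumₚ (map (λ y → ∑⟨ b ⟩ (λ u → f u * g y u)) xs)
    ≈⟨ +-congˡ (sumₚ-∑⟨⟩ b f g xs) ⟩
  ∑⟨ b ⟩ (λ u → f u * g x u) + ∑⟨ b ⟩ (λ u → f u * sumₚ (map (λ y → g y u) xs))
    ≈⟨ ∑⟨⟩-+ b (λ u → f u * g x u) (λ u → f u * sumₚ (map (λ y → g y u) xs)) ⟨
  ∑⟨ b ⟩ (λ u → f u * g x u + f u * sumₚ (map (λ y → g y u) xs))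
    ≈⟨ ∑⟨⟩-cong (λ u _ → sym (distribˡ (f u) (g x u) _)) ⟩
  ∑⟨ b ⟩ (λ u → f u * sumₚ (map (λ y → g y u) (x ∷ xs)))
    ∎
  where open ≈-Reasoning

∈-tabulate⁺ : ∀ {m} {b : Fin m → Bool} {x} → T (b x) → x ∈ Vec.tabulate b
∈-tabulate⁺ {b = b} {x} bx =
  lookup⇒[]= x (Vec.tabulate b) (≡.trans (Vecₚ.lookup∘tabulate b x) (Equivalence.to T-≡ bx))

∈-tabulate⁻ : ∀ {m} {b : Fin m → Bool} {x} → x ∈ Vec.tabulate b → T (b x)
∈-tabulate⁻ {b = b} {x} x∈b =
  Equivalence.from T-≡ (≡.trans (≡.sym (Vecₚ.lookup∘tabulate b x)) ([]=⇒lookup x∈b))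

tabulate-⊂ : ∀ {m} {b c : Fin m → Bool} y → (∀ u → T (b u) → T (c u)) → T (c y) → ¬ T (b y) →
             Vec.tabulate b ⊂ Vec.tabulate c
tabulate-⊂ y b⇒c cy ¬by =
  (λ {x} x∈b → ∈-tabulate⁺ (b⇒c x (∈-tabulate⁻ x∈b))) , y , ∈-tabulate⁺ cy , ¬by ∘ ∈-tabulate⁻

∣tabulate∣< : ∀ {m} {b : Fin m → Bool} y → ¬ T (b y) → ∣ Vec.tabulate b ∣ ℕ.< m
∣tabulate∣< {m} y ¬by =
  ≡.subst (ℕ._<_ _) (∣⊤∣≡n m) (p⊂q⇒∣p∣<∣q∣ (⊆⊤ , y , ∈⊤ , ¬by ∘ ∈-tabulate⁻))

module Incidence {n : ℕ} (P : GradedBoundedPoset n) where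

  open GradedBoundedPoset P
  open IsDecPartialOrder isDecPO using (antisym) renaming (refl to ≤-refl; trans to ≤-trans)

  _≤ᵇ_ : Fin n → Fin n → Bool
  s ≤ᵇ u = does (s ≤? u)

  ≤ᵇ-refl : ∀ s → T (s ≤ᵇ s)
  ≤ᵇ-refl s = T-does⁺ (s ≤? s) ≤-refl

  ≤ᵇ-top : ∀ u → u ≤ᵇ top ≡ true
  ≤ᵇ-top u = dec-true (u ≤? top) (top-max u)

  ≤ᵇ-trans-∧ : ∀ s u w → s ≤ᵇ w ∧ (s ≤ᵇ u ∧ u ≤ᵇ w) ≡ s ≤ᵇ u ∧ u ≤ᵇ w
  ≤ᵇ-trans-∧ s u w = ∧-absorb (s ≤ᵇ u) (u ≤ᵇ w) (s ≤ᵇ w) λ s≤u u≤w →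
    T-does⁺ (s ≤? w) (≤-trans (T-does⁻ (s ≤? u) s≤u) (T-does⁻ (u ≤? w) u≤w))

  <ᵇ⇒≤ : ∀ {s u} → T (s <ᵇ u) → s ≤ u
  <ᵇ⇒≤ {s} {u} s<u = T-does⁻ (s ≤? u) (proj₁ (T-∧⁻ (s ≤ᵇ u) s<u))

  <ᵇ⇒≢ : ∀ {s u} → T (s <ᵇ u) → s ≢ u
  <ᵇ⇒≢ {s} {u} s<u = T-not-does⁻ (s ≟ u) (proj₂ (T-∧⁻ (s ≤ᵇ u) s<u))

  ≤∧≢⇒<ᵇ : ∀ {s u} → s ≤ u → s ≢ u → T (s <ᵇ u)
  ≤∧≢⇒<ᵇ {s} {u} s≤u s≢u = T-∧⁺ (T-does⁺ (s ≤? u) s≤u) (T-not-does⁺ (s ≟ u) s≢u)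

  <ᵇ-irrefl : ∀ s → ¬ T (s <ᵇ s)
  <ᵇ-irrefl s s<s = <ᵇ⇒≢ s<s ≡.refl

  <ᵇ-trans : ∀ {s p u} → T (s <ᵇ p) → T (p <ᵇ u) → T (s <ᵇ u)
  <ᵇ-trans s<p p<u = ≤∧≢⇒<ᵇ (≤-trans (<ᵇ⇒≤ s<p) (<ᵇ⇒≤ p<u))
    λ { ≡.refl → <ᵇ⇒≢ p<u (antisym (<ᵇ⇒≤ p<u) (<ᵇ⇒≤ s<p)) }

  -- A strict chain starting at s (ending at u) has at most ∣ ↑ s ∣ (∣ ↓ u ∣) steps,
  -- which is the fuel that chainSum≤ (μ') needs.
  ↑_ ↓_ : Fin n → Subset n
  ↑ s = Vec.tabulate (s <ᵇ_)
  ↓ u = Vec.tabulate (_<ᵇ u)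

  ∣↑∣-mono : ∀ {s p} → T (s <ᵇ p) → ∣ ↑ p ∣ ℕ.< ∣ ↑ s ∣
  ∣↑∣-mono {s} {p} s<p = p⊂q⇒∣p∣<∣q∣ (tabulate-⊂ p (λ u p<u → <ᵇ-trans s<p p<u) s<p (<ᵇ-irrefl p))

  ∣↓∣-mono : ∀ {v u} → T (v <ᵇ u) → ∣ ↓ v ∣ ℕ.< ∣ ↓ u ∣
  ∣↓∣-mono {v} {u} v<u = p⊂q⇒∣p∣<∣q∣ (tabulate-⊂ v (λ w w<v → <ᵇ-trans w<v v<u) v<u (<ᵇ-irrefl v))

  ∣↑∣<n : ∀ s → ∣ ↑ s ∣ ℕ.< n
  ∣↑∣<n s = ∣tabulate∣< s (<ᵇ-irrefl s)

  ∣↓∣<n : ∀ u → ∣ ↓ u ∣ ℕ.< n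
  ∣↓∣<n u = ∣tabulate∣< u (<ᵇ-irrefl u)

  -- Induction on the number of elements strictly between s and w: either one of
  -- them splits the interval, or w covers s.
  ρ-mono-< : ∀ {s w} → T (s <ᵇ w) → ρ s ℕ.< ρ w
  ρ-mono-< = go _ ℕₚ.≤-refl
    where
    ⟪_,_⟫ : Fin n → Fin n → Subset n
    ⟪ s , w ⟫ = Vec.tabulate (λ u → s <ᵇ u ∧ u <ᵇ w)

    go : ∀ fuel {s w} → ∣ ⟪ s , w ⟫ ∣ ℕ.< fuel → T (s <ᵇ w) → ρ s ℕ.< ρ w
    go (suc f) {s} {w} bound s<w with any? (λ u → T? (s <ᵇ u ∧ u <ᵇ w))
    ... | yes (u , s<u<w) =
      ℕₚ.<-trans (go f (shrink ⟪s,u⟫⊂⟪s,w⟫) s<u) (go f (shrink ⟪u,w⟫⊂⟪s,w⟫) u<w)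
      where
      s<u = proj₁ (T-∧⁻ (s <ᵇ u) s<u<w)
      u<w = proj₂ (T-∧⁻ (s <ᵇ u) s<u<w)
      shrink : ∀ {p} → p ⊂ ⟪ s , w ⟫ → ∣ p ∣ ℕ.< f
      shrink p⊂ = ℕₚ.<-≤-trans (p⊂q⇒∣p∣<∣q∣ p⊂) (ℕₚ.≤-pred bound)
      ⟪s,u⟫⊂⟪s,w⟫ : ⟪ s , u ⟫ ⊂ ⟪ s , w ⟫
      ⟪s,u⟫⊂⟪s,w⟫ = tabulate-⊂ u
        (λ v s<v<u → let s<v , v<u = T-∧⁻ (s <ᵇ v) s<v<u in T-∧⁺ s<v (<ᵇ-trans v<u u<w))
        s<u<w (<ᵇ-irrefl u ∘ proj₂ ∘ T-∧⁻ (s <ᵇ u))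
      ⟪u,w⟫⊂⟪s,w⟫ : ⟪ u , w ⟫ ⊂ ⟪ s , w ⟫
      ⟪u,w⟫⊂⟪s,w⟫ = tabulate-⊂ u
        (λ v u<v<w → let u<v , v<w = T-∧⁻ (u <ᵇ v) u<v<w in T-∧⁺ (<ᵇ-trans s<u u<v) v<w)
        s<u<w (<ᵇ-irrefl u ∘ proj₁ ∘ T-∧⁻ (u <ᵇ u))
    ... | no ∄u = ℕₚ.≤-reflexive (≡.sym (ρ-cover s w (<ᵇ⇒≤ s<w) (<ᵇ⇒≢ s<w) s⋖w))
      where
      s⋖w : ∀ u → s ≤ u → u ≤ w → u ≡ s ⊎ u ≡ w
      s⋖w u s≤u u≤w with u ≟ s | u ≟ w
      ... | yes u≡s | _       = inj₁ u≡s
      ... | no _    | yes u≡w = inj₂ u≡w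
      ... | no u≢s  | no u≢w  =
        ⊥-elim (∄u (u , T-∧⁺ (≤∧≢⇒<ᵇ s≤u (u≢s ∘ ≡.sym)) (≤∧≢⇒<ᵇ u≤w u≢w)))

  -- Incidence functions acting on columns

  _▷_ : Inc → (Fin n → Poly) → Fin n → Poly
  (a ▷ v) s = ∑⟨ s ≤ᵇ_ ⟩ (λ w → a s w * v w)

  ⋆≈∑ : ∀ a b s t → (a ⋆ b) s t ≈ ∑⟨ (λ u → s ≤ᵇ u ∧ u ≤ᵇ t) ⟩ (λ u → a s u * b u t)
  ⋆≈∑ a b s t = sumₚ-filter-allFin (λ u → (s ≤? u) ×-dec (u ≤? t)) (λ u → a s u * b u t)

  ⋆-top : ∀ a b s → (a ⋆ b) s top ≈ (a ▷ (λ w → b w top)) s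
  ⋆-top a b s = trans (⋆≈∑ a b s top) (∑⟨⟩-guard (λ u → a s u * b u top)
    (λ u → ≡.trans (cong (s ≤ᵇ u ∧_) (≤ᵇ-top u)) (∧-identityʳ (s ≤ᵇ u))))

  ⋆-refl : ∀ a b s → (a ⋆ b) s s ≈ a s s * b s s
  ⋆-refl a b s = begin
    (a ⋆ b) s s
      ≈⟨ ⋆≈∑ a b s s ⟩
    ∑⟨ s≤u≤s ⟩ g
      ≈⟨ ∑⟨⟩-split s≤u≤s s g (T-∧⁺ (≤ᵇ-refl s) (≤ᵇ-refl s)) ⟩
    g s + ∑⟨ (λ u → s≤u≤s u ∧ not (s ≟ᵇ u)) ⟩ g
      ≈⟨ +-congˡ {x = g s} (∑⟨⟩-zero _ g (λ u → ⊥-elim ∘ outside u)) ⟩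
    g s + 0#
      ≈⟨ +-identityʳ (g s) ⟩
    g s
      ∎
    where
    open ≈-Reasoning
    s≤u≤s : Fin n → Bool
    s≤u≤s u = s ≤ᵇ u ∧ u ≤ᵇ s
    g : Fin n → Poly
    g u = a s u * b u s
    outside : ∀ u → ¬ T (s≤u≤s u ∧ not (s ≟ᵇ u))
    outside u h =
      let s≤u∧u≤s , s≢u = T-∧⁻ (s≤u≤s u) h
          s≤u , u≤s     = T-∧⁻ (s ≤ᵇ u) s≤u∧u≤s
      in T-not-does⁻ (s ≟ u) s≢u (antisym (T-does⁻ (s ≤? u) s≤u) (T-does⁻ (u ≤? s) u≤s))

  ▷-congˡ : ∀ a b → a ≈I b → ∀ v s → (a ▷ v) s ≈ (b ▷ v) s
  ▷-congˡ a b a≈b v s = ∑⟨⟩-cong λ w s≤w →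
    *-congʳ {x = v w} (mk≈ {a s w} {b s w} (a≈b s w (T-does⁻ (s ≤? w) s≤w)))

  ▷-congʳ : ∀ a {u v} → (∀ w → u w ≈ v w) → ∀ s → (a ▷ u) s ≈ (a ▷ v) s
  ▷-congʳ a u≈v s = ∑⟨⟩-cong (λ w _ → *-congˡ {x = a s w} (u≈v w))

  δ-▷ : ∀ v s → (δ ▷ v) s ≈ v s
  δ-▷ v s = trans (∑⟨⟩-restrict (s ≤ᵇ_) (s ≟ᵇ_) v s≡u⇒s≤u) (∑-δ s v)
    where
    s≡u⇒s≤u : ∀ u → T (s ≟ᵇ u) → T (s ≤ᵇ u)
    s≡u⇒s≤u u s≡u = ≡.subst (T ∘ (s ≤ᵇ_)) (T-does⁻ (s ≟ u) s≡u) (≤ᵇ-refl s)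

  ⋆-▷ : ∀ a b v s → ((a ⋆ b) ▷ v) s ≈ (a ▷ (b ▷ v)) s
  ⋆-▷ a b v s = begin
    ∑⟨ s ≤ᵇ_ ⟩ (λ w → (a ⋆ b) s w * v w)
      ≈⟨ ∑⟨⟩-cong (λ w _ → trans (*-congʳ {x = v w} (⋆≈∑ a b s w))
                                 (sym (∑⟨⟩-*ʳ (λ u → s ≤ᵇ u ∧ u ≤ᵇ w) (v w) (λ u → a s u * b u w)))) ⟩
    ∑⟨ s ≤ᵇ_ ⟩ (λ w → ∑⟨ (λ u → s ≤ᵇ u ∧ u ≤ᵇ w) ⟩ (λ u → a s u * b u w * v w))
      ≈⟨ ∑⟨⟩-swap (s ≤ᵇ_) (λ w u → s ≤ᵇ u ∧ u ≤ᵇ w) (s ≤ᵇ_) _≤ᵇ_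
                  (λ w u → a s u * b u w * v w) (λ w u → ≤ᵇ-trans-∧ s u w) ⟩
    ∑⟨ s ≤ᵇ_ ⟩ (λ u → ∑⟨ u ≤ᵇ_ ⟩ (λ w → a s u * b u w * v w))
      ≈⟨ ∑⟨⟩-cong (λ u _ → trans (∑⟨⟩-cong (λ w _ → *-assoc (a s u) (b u w) (v w)))
                                 (∑⟨⟩-* (u ≤ᵇ_) (a s u) (λ w → b u w * v w))) ⟩
    ∑⟨ s ≤ᵇ_ ⟩ (λ u → a s u * ∑⟨ u ≤ᵇ_ ⟩ (λ w → b u w * v w))
      ∎
    where open ≈-Reasoning

  ▷-injective : ∀ a b → (b ⋆ a) ≈I δ → ∀ u v → (∀ s → (a ▷ u) s ≈ (a ▷ v) s) → ∀ s → u s ≈ v s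
  ▷-injective a b b⋆a≈δ u v a▷u≈a▷v s = begin
    u s                ≈⟨ δ-▷ u s ⟨
    (δ ▷ u) s          ≈⟨ ▷-congˡ (b ⋆ a) δ b⋆a≈δ u s ⟨
    ((b ⋆ a) ▷ u) s    ≈⟨ ⋆-▷ b a u s ⟩
    (b ▷ (a ▷ u)) s    ≈⟨ ▷-congʳ b a▷u≈a▷v s ⟩
    (b ▷ (a ▷ v)) s    ≈⟨ ⋆-▷ b a v s ⟨
    ((b ⋆ a) ▷ v) s    ≈⟨ ▷-congˡ (b ⋆ a) δ b⋆a≈δ v s ⟩
    (δ ▷ v) s          ≈⟨ δ-▷ v s ⟩
    v s                ∎
    where open ≈-Reasoning

  ▷-neg : ∀ a v s → (a ▷ (λ w → - v w)) s ≈ - (a ▷ v) s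
  ▷-neg a v s = begin
    ∑⟨ s ≤ᵇ_ ⟩ (λ w → a s w * - v w)           ≈⟨ ∑⟨⟩-cong (λ w _ → pull-neg (a s w) (v w)) ⟩
    ∑⟨ s ≤ᵇ_ ⟩ (λ w → - 1# * (a s w * v w))    ≈⟨ ∑⟨⟩-* (s ≤ᵇ_) (- 1#) (λ w → a s w * v w) ⟩
    - 1# * (a ▷ v) s                           ≈⟨ neg-one ((a ▷ v) s) ⟩
    - (a ▷ v) s                                ∎
    where
    open ≈-Reasoning
    pull-neg : ∀ x y → x * - y ≈ - 1# * (x * y)
    pull-neg = solve-∀ almostCommutativeRing
    neg-one : ∀ x → - 1# * x ≈ - x
    neg-one = solve-∀ almostCommutativeRing

  ▷-split : ∀ a v s → (a ▷ v) s ≈ a s s * v s + ∑⟨ s <ᵇ_ ⟩ (λ w → a s w * v w)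
  ▷-split a v s = ∑⟨⟩-split (s ≤ᵇ_) s (λ w → a s w * v w) (≤ᵇ-refl s)

  -- The Möbius function

  μ'-stable : ∀ f g {s u} → ∣ ↓ u ∣ ℕ.< f → ∣ ↓ u ∣ ℕ.< g → μ' f s u ≡ μ' g s u
  μ'-stable (suc f) (suc g) {s} {u} bf bg with does (s ≟ u) | does (s ≤? u)
  ... | true  | _     = ≡.refl
  ... | false | false = ≡.refl
  ... | false | true  =
    cong (λ zs → ℤ.- sumℤ zs) (Listₚ.map-cong-local (All.map below (all-filter _ (allFin n))))
    where
    below : ∀ {v} → s ≤ v × v ≤ u × v ≢ u → μ' f s v ≡ μ' g s v
    below (_ , v≤u , v≢u) =
      μ'-stable f g (ℕₚ.<-≤-trans v<u (ℕₚ.≤-pred bf)) (ℕₚ.<-≤-trans v<u (ℕₚ.≤-pred bg))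
      where v<u = ∣↓∣-mono (≤∧≢⇒<ᵇ v≤u v≢u)

  μ'-unfold : ∀ m {s u} → ∣ ↓ u ∣ ℕ.< m → s ≤ u → s ≢ u →
              μ' m s u ≡ ℤ.- sumℤ (map (μ' m s) (intervalCO s u))
  μ'-unfold (suc f) {s} {u} bound s≤u s≢u with s ≟ u | s ≤? u
  ... | yes s≡u | _       = ⊥-elim (s≢u s≡u)
  ... | no _    | no s≰u  = ⊥-elim (s≰u s≤u)
  ... | no _    | yes _   =
    cong (λ zs → ℤ.- sumℤ zs) (Listₚ.map-cong-local (All.map below (all-filter _ (allFin n))))
    where
    below : ∀ {v} → s ≤ v × v ≤ u × v ≢ u → μ' f s v ≡ μ' (suc f) s v
    below (_ , v≤u , v≢u) =
      μ'-stable f (suc f) (ℕₚ.<-≤-trans v<u (ℕₚ.≤-pred bound)) (ℕₚ.<-trans v<u bound)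
      where v<u = ∣↓∣-mono (≤∧≢⇒<ᵇ v≤u v≢u)

  μ-unfold : ∀ {s u} → s ≤ u → s ≢ u → μ s u ≡ ℤ.- sumℤ (map (μ s) (intervalCO s u))
  μ-unfold {u = u} = μ'-unfold n (∣↓∣<n u)

  μ-refl : ∀ s → μ s s ≡ 1ℤ
  μ-refl s = go n (ℕₚ.≤-<-trans ℕ.z≤n (∣↓∣<n s))
    where
    go : ∀ m → 0 ℕ.< m → μ' m s s ≡ 1ℤ
    go (suc f) _ with s ≟ s
    ... | yes _  = ≡.refl
    ... | no s≢s = ⊥-elim (s≢s ≡.refl)

  ζ μₚ : Inc
  ζ _ _  = 1#
  μₚ s t = constₚ (μ s t)

  μ⋆ζ≈δ : (μₚ ⋆ ζ) ≈I δ
  μ⋆ζ≈δ s w s≤w = coeff-≈ (μ⋆ζ≈δ′ s w s≤w)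
    where
    μ⋆ζ≈δ′ : ∀ s w → s ≤ w → (μₚ ⋆ ζ) s w ≈ δ s w
    μ⋆ζ≈δ′ s w s≤w with s ≟ w
    ... | yes ≡.refl = begin
      (μₚ ⋆ ζ) s s       ≈⟨ ⋆-refl μₚ ζ s ⟩
      μₚ s s * 1#        ≈⟨ *-identityʳ (μₚ s s) ⟩
      constₚ (μ s s)     ≡⟨ cong constₚ (μ-refl s) ⟩
      1#                 ∎
      where open ≈-Reasoning
    ... | no s≢w = begin
      (μₚ ⋆ ζ) s w
        ≈⟨ ⋆≈∑ μₚ ζ s w ⟩
      ∑⟨ s≤u≤w ⟩ (λ u → μₚ s u * 1#)
        ≈⟨ ∑⟨⟩-split s≤u≤w w (λ u → μₚ s u * 1#) (T-∧⁺ (T-does⁺ (s ≤? w) s≤w) (≤ᵇ-refl w)) ⟩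
      μₚ s w * 1# + ∑⟨ (λ u → s≤u≤w u ∧ not (w ≟ᵇ u)) ⟩ (λ u → μₚ s u * 1#)
        ≈⟨ +-cong (*-identityʳ (μₚ s w)) (trans (∑⟨⟩-guard (λ u → μₚ s u * 1#) reassoc)
                                               (∑⟨⟩-cong (λ u _ → *-identityʳ (μₚ s u)))) ⟩
      μₚ s w + ∑⟨ (λ u → does (below? u)) ⟩ (μₚ s)
        ≈⟨ +-cong (reflexive (cong constₚ (μ-unfold s≤w s≢w))) (sym (sumₚ-filter-allFin below? (μₚ s))) ⟩
      - constₚ (sumℤ (map (μ s) (intervalCO s w))) + sumₚ (map (μₚ s) (intervalCO s w))
        ≈⟨ +-congʳ (-‿cong (constₚ-sumℤ (μ s) (intervalCO s w))) ⟩
      - sumₚ (map (μₚ s) (intervalCO s w)) + sumₚ (map (μₚ s) (intervalCO s w))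
        ≈⟨ -‿inverseˡ (sumₚ (map (μₚ s) (intervalCO s w))) ⟩
      0#
        ∎
      where
      open ≈-Reasoning
      s≤u≤w : Fin n → Bool
      s≤u≤w u = s ≤ᵇ u ∧ u ≤ᵇ w
      below? : ∀ u → Dec (s ≤ u × u ≤ w × u ≢ w)
      below? u = (s ≤? u) ×-dec ((u ≤? w) ×-dec ¬? (u ≟ w))
      reassoc : ∀ u → s≤u≤w u ∧ not (w ≟ᵇ u) ≡ does (below? u)
      reassoc u = ≡.trans (∧-assoc (s ≤ᵇ u) (u ≤ᵇ w) _)
                          (cong (λ c → s ≤ᵇ u ∧ (u ≤ᵇ w ∧ not c)) (≟ᵇ-sym w u))
      -‿inverseˡ : ∀ x → - x + x ≈ 0#
      -‿inverseˡ = solve-∀ almostCommutativeRing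

  -- The characteristic function

  rankPower edgeWeight : Inc
  rankPower  s t = xpow ρ[ s , t ]
  edgeWeight s t = chainFactor ρ[ s , t ]

  chainFactor-spec : ∀ d → 0 ℕ.< d → (X + - 1#) * chainFactor d ≈ xpow d + - X
  chainFactor-spec (suc e) _ = begin
    (X + - 1#) * divX1 (X * (xpow e + - 1#))  ≈⟨ divX1-correct (X * (xpow e + - 1#)) at1≡0 ⟩
    X * (xpow e + - 1#)                       ≈⟨ distrib X (xpow e) ⟩
    X * xpow e + - X                          ≈⟨ +-congʳ (X*≈0∷ (xpow e)) ⟩
    xpow (suc e) + - X                        ∎
    where
    open ≈-Reasoning
    distrib : ∀ x y → x * (y + - 1#) ≈ x * y + - x
    distrib = solve-∀ almostCommutativeRing
    at1≡0 : eval₁ (X * (xpow e + - 1#)) ≡ 0ℤ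
    at1≡0 = ≡.trans (eval₁-* X (xpow e + - 1#))
      (cong (1ℤ ℤ.*_) (≡.trans (eval₁-+ (xpow e) (- 1#)) (cong (ℤ._+ -1ℤ) (eval₁-xpow e))))

  rankPower-refl : ∀ s → rankPower s s ≈ 1#
  rankPower-refl s = reflexive (cong xpow (ℕₚ.n∸n≡0 (ρ s)))

  rankPower-< : ∀ {s w} → T (s <ᵇ w) → rankPower s w ≈ (X + - 1#) * edgeWeight s w + X
  rankPower-< {s} {w} s<w = begin
    xpow ρ[ s , w ]                  ≈⟨ split (xpow ρ[ s , w ]) X ⟩
    (xpow ρ[ s , w ] + - X) + X      ≈⟨ +-congʳ (chainFactor-spec ρ[ s , w ] 0<ρ[s,w]) ⟨
    (X + - 1#) * edgeWeight s w + X  ∎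
    where
    open ≈-Reasoning
    split : ∀ p x → p ≈ (p + - x) + x
    split = solve-∀ almostCommutativeRing
    0<ρ[s,w] : 0 ℕ.< ρ[ s , w ]
    0<ρ[s,w] = ℕₚ.m<n⇒0<n∸m (ρ-mono-< s<w)

  χ-refl : ∀ s → χ s s ≈ 1#
  χ-refl s = begin
    χ s s                          ≈⟨ ⋆-refl μₚ rankPower s ⟩
    μₚ s s * rankPower s s         ≈⟨ *-cong (reflexive (cong constₚ (μ-refl s))) (rankPower-refl s) ⟩
    1# * 1#                        ≈⟨ *-identityˡ 1# ⟩
    1#                             ∎
    where open ≈-Reasoning

  χ-at-1 : ∀ {s w} → s ≤ w → s ≢ w → eval₁ (χ s w) ≡ 0ℤ
  χ-at-1 {s} {w} s≤w s≢w = begin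
    eval₁ ((μₚ ⋆ rankPower) s w)
      ≡⟨ eval₁-sumₚ-cong (interval s w) (λ u → eval₁-*-xpow (μₚ s u) ρ[ u , w ]) ⟩
    eval₁ ((μₚ ⋆ ζ) s w)
      ≡⟨ eval₁-cong (mk≈ {(μₚ ⋆ ζ) s w} {δ s w} (μ⋆ζ≈δ s w s≤w)) ⟩
    eval₁ (δ s w)
      ≡⟨ cong (λ b → eval₁ ⟦ b ⟧) (dec-false (s ≟ w) s≢w) ⟩
    0ℤ
      ∎
    where open ≡.≡-Reasoning

  χ̄-spec : ∀ {s w} → s ≤ w → (X + - 1#) * χ̄ s w ≈ χ s w + - (X * δ s w)
  χ̄-spec {s} {w} s≤w with s ≟ w
  ... | yes ≡.refl = begin
    (X + - 1#) * - 1#     ≈⟨ identity X ⟩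
    1# + - (X * 1#)       ≈⟨ +-congʳ (χ-refl s) ⟨
    χ s s + - (X * 1#)    ∎
    where
    open ≈-Reasoning
    identity : ∀ x → (x + - 1#) * - 1# ≈ 1# + - (x * 1#)
    identity = solve-∀ almostCommutativeRing
  ... | no s≢w = trans (divX1-correct (χ s w) (χ-at-1 s≤w s≢w)) (identity (χ s w) X)
    where
    identity : ∀ c x → c ≈ c + - (x * 0#)
    identity = solve-∀ almostCommutativeRing

  -- Chain sums

  chainSum≤ : ℕ → Fin n → Poly
  chainSum≤ zero    s = 1#
  chainSum≤ (suc k) s = 1# + ∑⟨ s <ᵇ_ ⟩ (λ p → edgeWeight s p * chainSum≤ k p)

  chainSum≤-stable : ∀ k k′ {s} → ∣ ↑ s ∣ ℕ.< k → ∣ ↑ s ∣ ℕ.< k′ → chainSum≤ k s ≈ chainSum≤ k′ s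
  chainSum≤-stable (suc k) (suc k′) bound bound′ = +-congˡ {x = 1#} (∑⟨⟩-cong λ p s<p →
    *-congˡ {x = edgeWeight _ p} (chainSum≤-stable k k′
      (ℕₚ.<-≤-trans (∣↑∣-mono s<p) (ℕₚ.≤-pred bound))
      (ℕₚ.<-≤-trans (∣↑∣-mono s<p) (ℕₚ.≤-pred bound′))))

  chainSumFrom : Fin n → Poly
  chainSumFrom = chainSum≤ n

  chainSumFrom-unfold : ∀ s → chainSumFrom s ≈ 1# + ∑⟨ s <ᵇ_ ⟩ (λ p → edgeWeight s p * chainSumFrom p)
  chainSumFrom-unfold s = unfold n ∣↑∣<n
    where
    unfold : ∀ k → (∀ p → ∣ ↑ p ∣ ℕ.< k) →
             chainSum≤ k s ≈ 1# + ∑⟨ s <ᵇ_ ⟩ (λ p → edgeWeight s p * chainSum≤ k p)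
    unfold zero    bound = ⊥-elim (ℕₚ.n≮0 (bound s))
    unfold (suc k) bound = +-congˡ {x = 1#} (∑⟨⟩-cong λ p s<p → *-congˡ {x = edgeWeight s p}
      (chainSum≤-stable k (suc k) (ℕₚ.<-≤-trans (∣↑∣-mono s<p) (ℕₚ.≤-pred (bound s))) (bound p)))

  chainsOfLength : ℕ → Fin n → Poly
  chainsOfLength m s = sumₚ (map (chainWeight s) (filter (λ c → isChainFrom s c Bool.≟ true) (lists m)))

  chainTerm : Fin n → List (Fin n) → Poly
  chainTerm s c = ⟦ isChainFrom s c ⟧ * chainWeight s c

  chainsOfLength≈ : ∀ m s → chainsOfLength m s ≈ sumₚ (map (chainTerm s) (lists m))
  chainsOfLength≈ m s =
    trans (sumₚ-map-filter (λ c → isChainFrom s c Bool.≟ true) (chainWeight s) (lists m))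
          (sumₚ-map-cong (lists m) λ c →
             reflexive (cong (λ b → ⟦ b ⟧ * chainWeight s c) (does-≟-true (isChainFrom s c))))

  chainsOfLength-zero : ∀ s → chainsOfLength 0 s ≈ 1#
  chainsOfLength-zero s = begin
    chainsOfLength 0 s              ≈⟨ chainsOfLength≈ 0 s ⟩
    ⟦ s ≤ᵇ top ⟧ * 1# + 0#          ≈⟨ +-identityʳ _ ⟩
    ⟦ s ≤ᵇ top ⟧ * 1#               ≡⟨ cong (λ b → ⟦ b ⟧ * 1#) (≤ᵇ-top s) ⟩
    1# * 1#                         ≈⟨ *-identityˡ 1# ⟩
    1#                              ∎
    where open ≈-Reasoning

  chainTerm-∷ : ∀ s p c → chainTerm s (p ∷ c) ≈ ⟦ s <ᵇ p ⟧ * edgeWeight s p * chainTerm p c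
  chainTerm-∷ s p c = trans (*-congʳ {x = edgeWeight s p * chainWeight p c} (⟦∧⟧ (s <ᵇ p) (isChainFrom p c)))
    (reassoc ⟦ s <ᵇ p ⟧ ⟦ isChainFrom p c ⟧ (edgeWeight s p) (chainWeight p c))
    where
    reassoc : ∀ a b f w → a * b * (f * w) ≈ a * f * (b * w)
    reassoc = solve-∀ almostCommutativeRing

  chainsOfLength-suc : ∀ m s →
    chainsOfLength (suc m) s ≈ ∑⟨ s <ᵇ_ ⟩ (λ p → edgeWeight s p * chainsOfLength m p)
  chainsOfLength-suc m s = begin
    chainsOfLength (suc m) s
      ≈⟨ chainsOfLength≈ (suc m) s ⟩
    sumₚ (map (chainTerm s) (concatMap (λ p → map (p ∷_) (lists m)) (allFin n)))
      ≈⟨ sumₚ-map-concatMap (chainTerm s) (λ p → map (p ∷_) (lists m)) (allFin n) ⟩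
    sumₚ (map (λ p → sumₚ (map (chainTerm s) (map (p ∷_) (lists m)))) (allFin n))
      ≈⟨ sumₚ-map-cong (allFin n) (λ p → begin
           sumₚ (map (chainTerm s) (map (p ∷_) (lists m)))       ≡⟨ cong sumₚ (Listₚ.map-∘ (lists m)) ⟨
           sumₚ (map (chainTerm s ∘ (p ∷_)) (lists m))           ≈⟨ sumₚ-map-cong (lists m) (chainTerm-∷ s p) ⟩
           sumₚ (map (λ c → ⟦ s <ᵇ p ⟧ * edgeWeight s p * chainTerm p c) (lists m))
             ≈⟨ sumₚ-map-* (⟦ s <ᵇ p ⟧ * edgeWeight s p) (chainTerm p) (lists m) ⟩
           ⟦ s <ᵇ p ⟧ * edgeWeight s p * sumₚ (map (chainTerm p) (lists m))
             ≈⟨ *-assoc ⟦ s <ᵇ p ⟧ (edgeWeight s p) (sumₚ (map (chainTerm p) (lists m))) ⟩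
           ⟦ s <ᵇ p ⟧ * (edgeWeight s p * sumₚ (map (chainTerm p) (lists m))) ∎) ⟩
    sumₚ (map (λ p → ⟦ s <ᵇ p ⟧ * (edgeWeight s p * sumₚ (map (chainTerm p) (lists m)))) (allFin n))
      ≡⟨ sumₚ-allFin (s <ᵇ_) (λ p → edgeWeight s p * sumₚ (map (chainTerm p) (lists m))) ⟩
    ∑⟨ s <ᵇ_ ⟩ (λ p → edgeWeight s p * sumₚ (map (chainTerm p) (lists m)))
      ≈⟨ ∑⟨⟩-cong (λ p _ → *-congˡ {x = edgeWeight s p} (chainsOfLength≈ m p)) ⟨
    ∑⟨ s <ᵇ_ ⟩ (λ p → edgeWeight s p * chainsOfLength m p)
      ∎
    where open ≈-Reasoning

  chainSum≤≈ : ∀ k s → sumₚ (map (λ m → chainsOfLength m s) (upTo (suc k))) ≈ chainSum≤ k s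
  chainSum≤≈ zero    s = trans (+-identityʳ (chainsOfLength 0 s)) (chainsOfLength-zero s)
  chainSum≤≈ (suc k) s = +-cong (chainsOfLength-zero s) (begin
    sumₚ (map L (applyUpTo suc (suc k)))
      ≡⟨ cong sumₚ (≡.trans (Listₚ.map-applyUpTo suc L (suc k))
                            (≡.sym (Listₚ.map-upTo (L ∘ suc) (suc k)))) ⟩
    sumₚ (map (λ m → chainsOfLength (suc m) s) (upTo (suc k)))
      ≈⟨ sumₚ-map-cong (upTo (suc k)) (λ m → chainsOfLength-suc m s) ⟩
    sumₚ (map (λ m → ∑⟨ s <ᵇ_ ⟩ (λ p → edgeWeight s p * chainsOfLength m p)) (upTo (suc k)))
      ≈⟨ sumₚ-∑⟨⟩ (s <ᵇ_) (edgeWeight s) (λ m p → chainsOfLength m p) (upTo (suc k)) ⟩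
    ∑⟨ s <ᵇ_ ⟩ (λ p → edgeWeight s p * sumₚ (map (λ m → chainsOfLength m p) (upTo (suc k))))
      ≈⟨ ∑⟨⟩-cong (λ p _ → *-congˡ {x = edgeWeight s p} (chainSum≤≈ k p)) ⟩
    ∑⟨ s <ᵇ_ ⟩ (λ p → edgeWeight s p * chainSum≤ k p)
      ∎)
    where
    open ≈-Reasoning
    L : ℕ → Poly
    L m = chainsOfLength m s

  chainSum≈chainSumFrom : chainSum ≈ chainSumFrom bot
  chainSum≈chainSumFrom = trans (sumₚ-concatMap chainsOfLengthList (upTo (suc n))) (chainSum≤≈ n bot)
    where
    chainsOfLengthList : ℕ → List Poly
    chainsOfLengthList m = map (chainWeight bot) (filter (λ c → isChainFrom bot c Bool.≟ true) (lists m))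

  rankPower▷chainSumFrom : ∀ u → (rankPower ▷ chainSumFrom) u ≈ X * (ζ ▷ chainSumFrom) u + (1# + - X)
  rankPower▷chainSumFrom u = begin
    (rankPower ▷ C) u
      ≈⟨ ▷-split rankPower C u ⟩
    rankPower u u * C u + ∑⟨ u <ᵇ_ ⟩ (λ w → rankPower u w * C w)
      ≈⟨ +-cong (*-congʳ {x = C u} (rankPower-refl u)) (∑⟨⟩-cong λ w u<w →
           trans (*-congʳ {x = C w} (rankPower-< u<w)) (expand X (edgeWeight u w) (C w))) ⟩
    1# * C u + ∑⟨ u <ᵇ_ ⟩ (λ w → (X + - 1#) * (edgeWeight u w * C w) + X * (1# * C w))
      ≈⟨ +-congˡ {x = 1# * C u}
           (∑⟨⟩-linear (u <ᵇ_) (X + - 1#) X (λ w → edgeWeight u w * C w) (λ w → 1# * C w)) ⟩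
    1# * C u + ((X + - 1#) * S + X * L)
      ≈⟨ +-congʳ (*-congˡ {x = 1#} (chainSumFrom-unfold u)) ⟩
    1# * (1# + S) + ((X + - 1#) * S + X * L)
      ≈⟨ collect X S L ⟩
    X * (1# * (1# + S) + L) + (1# + - X)
      ≈⟨ +-congʳ (*-congˡ {x = X} (+-congʳ (*-congˡ {x = 1#} (chainSumFrom-unfold u)))) ⟨
    X * (1# * C u + L) + (1# + - X)
      ≈⟨ +-congʳ (*-congˡ {x = X} (▷-split ζ C u)) ⟨
    X * (ζ ▷ C) u + (1# + - X)
      ∎
    where
    open ≈-Reasoning
    C = chainSumFrom
    S = ∑⟨ u <ᵇ_ ⟩ (λ w → edgeWeight u w * C w)
    L = ∑⟨ u <ᵇ_ ⟩ (λ w → 1# * C w)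
    expand : ∀ x e c → ((x + - 1#) * e + x) * c ≈ (x + - 1#) * (e * c) + x * (1# * c)
    expand = solve-∀ almostCommutativeRing
    collect : ∀ x s l → 1# * (1# + s) + ((x + - 1#) * s + x * l) ≈ x * (1# * (1# + s) + l) + (1# + - x)
    collect = solve-∀ almostCommutativeRing

  χ▷chainSumFrom : ∀ s → (χ ▷ chainSumFrom) s ≈ X * chainSumFrom s + (1# + - X) * δ s top
  χ▷chainSumFrom s = begin
    ((μₚ ⋆ rankPower) ▷ C) s
      ≈⟨ ⋆-▷ μₚ rankPower C s ⟩
    (μₚ ▷ (rankPower ▷ C)) s
      ≈⟨ ▷-congʳ μₚ (λ u → trans (rankPower▷chainSumFrom u)
                                  (+-congˡ {x = X * (ζ ▷ C) u} (sym (*-identityʳ _)))) s ⟩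
    (μₚ ▷ (λ u → X * (ζ ▷ C) u + (1# + - X) * 1#)) s
      ≈⟨ trans (∑⟨⟩-cong (λ u _ → distribute (μₚ s u) X ((ζ ▷ C) u) (1# + - X) 1#))
               (∑⟨⟩-linear (s ≤ᵇ_) X (1# + - X) (λ u → μₚ s u * (ζ ▷ C) u) (λ u → μₚ s u * 1#)) ⟩
    X * (μₚ ▷ (ζ ▷ C)) s + (1# + - X) * (μₚ ▷ (λ _ → 1#)) s
      ≈⟨ +-cong (*-congˡ {x = X} (⋆-▷ μₚ ζ C s)) (*-congˡ {x = 1# + - X} (⋆-top μₚ ζ s)) ⟨
    X * ((μₚ ⋆ ζ) ▷ C) s + (1# + - X) * (μₚ ⋆ ζ) s top
      ≈⟨ +-cong (*-congˡ {x = X} (▷-congˡ (μₚ ⋆ ζ) δ μ⋆ζ≈δ C s))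
                (*-congˡ {x = 1# + - X} (mk≈ {(μₚ ⋆ ζ) s top} {δ s top} (μ⋆ζ≈δ s top (top-max s)))) ⟩
    X * (δ ▷ C) s + (1# + - X) * δ s top
      ≈⟨ +-congʳ (*-congˡ {x = X} (δ-▷ C s)) ⟩
    X * C s + (1# + - X) * δ s top
      ∎
    where
    open ≈-Reasoning
    C = chainSumFrom
    distribute : ∀ m x e y o → m * (x * e + y * o) ≈ x * (m * e) + y * (m * o)
    distribute = solve-∀ almostCommutativeRing

  χ̄▷chainSumFrom : ∀ s → (χ̄ ▷ chainSumFrom) s ≈ - δ s top
  χ̄▷chainSumFrom s = [X-1]*-cancelˡ _ _ (begin
    (X + - 1#) * (χ̄ ▷ C) s
      ≈⟨ ∑⟨⟩-* (s ≤ᵇ_) (X + - 1#) (λ w → χ̄ s w * C w) ⟨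
    ∑⟨ s ≤ᵇ_ ⟩ (λ w → (X + - 1#) * (χ̄ s w * C w))
      ≈⟨ ∑⟨⟩-cong (λ w s≤w → begin
           (X + - 1#) * (χ̄ s w * C w)          ≈⟨ *-assoc (X + - 1#) (χ̄ s w) (C w) ⟨
           (X + - 1#) * χ̄ s w * C w            ≈⟨ *-congʳ {x = C w} (χ̄-spec (T-does⁻ (s ≤? w) s≤w)) ⟩
           (χ s w + - (X * δ s w)) * C w       ≈⟨ split (χ s w) X (δ s w) (C w) ⟩
           1# * (χ s w * C w) + - X * (δ s w * C w) ∎) ⟩
    ∑⟨ s ≤ᵇ_ ⟩ (λ w → 1# * (χ s w * C w) + - X * (δ s w * C w))
      ≈⟨ ∑⟨⟩-linear (s ≤ᵇ_) 1# (- X) (λ w → χ s w * C w) (λ w → δ s w * C w) ⟩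
    1# * (χ ▷ C) s + - X * (δ ▷ C) s
      ≈⟨ +-cong (*-congˡ {x = 1#} (χ▷chainSumFrom s)) (*-congˡ {x = - X} (δ-▷ C s)) ⟩
    1# * (X * C s + (1# + - X) * δ s top) + - X * C s
      ≈⟨ collect X (C s) (δ s top) ⟩
    (X + - 1#) * - δ s top
      ∎)
    where
    open ≈-Reasoning
    C = chainSumFrom
    split : ∀ c x d h → (c + - (x * d)) * h ≈ 1# * (c * h) + - x * (d * h)
    split = solve-∀ almostCommutativeRing
    collect : ∀ x c d → 1# * (x * c + (1# + - x) * d) + - x * c ≈ (x + - 1#) * - d
    collect = solve-∀ almostCommutativeRing

theorem4p1 : (n : ℕ) (P : GradedBoundedPoset n) →
    let open GradedBoundedPoset P in
    (inv : Inc) → IsInverse χ̄ inv →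
    -- H = -(χ̄)⁻¹, and H_P = H_{bot,top}
    negₚ (inv bot top) ≈ₚ chainSum
theorem4p1 n P inv (χ̄⋆inv≈δ , inv⋆χ̄≈δ) = coeff-≈ (begin
    - inv bot top     ≈⟨ ▷-injective χ̄ inv inv⋆χ̄≈δ (λ w → - inv w top) chainSumFrom χ̄▷-inv bot ⟩
    chainSumFrom bot  ≈⟨ chainSum≈chainSumFrom ⟨
    chainSum          ∎)
  where
  open GradedBoundedPoset P
  open Incidence P
  open ≈-Reasoning
  χ̄▷-inv : ∀ s → (χ̄ ▷ (λ w → - inv w top)) s ≈ (χ̄ ▷ chainSumFrom) s
  χ̄▷-inv s = begin
    (χ̄ ▷ (λ w → - inv w top)) s    ≈⟨ ▷-neg χ̄ (λ w → inv w top) s ⟩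
    - (χ̄ ▷ (λ w → inv w top)) s    ≈⟨ -‿cong (⋆-top χ̄ inv s) ⟨
    - (χ̄ ⋆ inv) s top              ≈⟨ -‿cong (mk≈ {(χ̄ ⋆ inv) s top} {δ s top} χ̄⋆inv≈δ[s,top]) ⟩
    - δ s top                      ≈⟨ χ̄▷chainSumFrom s ⟨
    (χ̄ ▷ chainSumFrom) s           ∎
    where χ̄⋆inv≈δ[s,top] = χ̄⋆inv≈δ s top (top-max s)
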